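{- Let $p\equiv1\pmod4$ be prime and let $h,k,q$ be positive integers. Then $s_\chi(qh,qk)=s_\chi(h,k)$ and $t_\chi(qh,qk)=q\,t_\chi(h,k)$.
   Context: $\chi_a=\left(\frac{a}{p}\right)$ is the Legendre symbol mod $p$. For real $x$, $((x))=x-\lfloor x\rfloor-\frac12+\frac12\mathbf{1}_{\mathbb{Z}}(x)$ (so $((x))=0$ for integers $x$). For positive integers $h,k$ let $\varphi=p/(k,p)$ (so $\varphi k=\mathrm{lcm}(k,p)$) and define \[s_\chi(h,k)=\sum_{\mu=0}^{\varphi k-1}\chi_\mu\Big(\Big(\frac{h\mu}{k}\Big)\Big)\Big(\Big(\frac{\mu}{\varphi k}\Big)\Big),\qquad t_\chi(h,k)=\frac1\varphi\sum_{\mu=0}^{\varphi k-1}\mu\chi_\mu\Big\lfloor\frac{h\mu}{k}\Big\rfloor.\] -}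

module Defs where

open import Data.Bool using (Bool; true; false; if_then_else_)
open import Data.Nat as ℕ using (ℕ; zero; suc; _≡ᵇ_)
open import Data.Nat.DivMod as DM using ()
open import Data.Nat.GCD using (gcd)
open import Data.Integer as ℤ using (ℤ; +_)
open import Data.List using (List; upTo)
open import Data.Bool.ListAction using (any)
open import Data.Rational as ℚ using (ℚ; floor; ↧ₙ_; ½; 0ℚ; _+_; _-_; _*_)

-- natural-number remainder / quotient, with an (unused) junk value for divisor 0
modℕ : ℕ → ℕ → ℕ
modℕ a zero = a
modℕ a (suc n) = a DM.% suc n

divℕ : ℕ → ℕ → ℕ
divℕ a zero = 0
divℕ a (suc n) = a DM./ suc n

-- the rational number a / b (junk value 0 if b = 0; only used with b > 0)
_÷ℤ_ : ℤ → ℕ → ℚ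
a ÷ℤ zero = 0ℚ
a ÷ℤ suc n = a ℚ./ suc n

isSquareMod : ℕ → ℕ → Bool
isSquareMod p a = any (λ x → modℕ (x ℕ.* x) p ≡ᵇ modℕ a p) (upTo p)

legendre : ℕ → ℕ → ℤ
legendre p a with modℕ a p ≡ᵇ 0
... | true = + 0
... | false = if isSquareMod p a then + 1 else ℤ.-[1+ 0 ]

-- sawtooth ((x)) = x - ⌊x⌋ - 1/2 + (1/2)·1_ℤ(x)
sawtooth : ℚ → ℚ
sawtooth x = x - (floor x ÷ℤ 1) - ½ + (if ↧ₙ x ≡ᵇ 1 then ½ else 0ℚ)

Σℚ : ℕ → (ℕ → ℚ) → ℚ
Σℚ zero f = 0ℚ
Σℚ (suc n) f = Σℚ n f + f n

Σℤ : ℕ → (ℕ → ℤ) → ℤ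
Σℤ zero f = + 0
Σℤ (suc n) f = Σℤ n f ℤ.+ f n

φ : ℕ → ℕ → ℕ
φ p k = divℕ p (gcd k p)

sχ : ℕ → ℕ → ℕ → ℚ
sχ p h k = Σℚ (φ p k ℕ.* k) (λ μ →
  (legendre p μ ÷ℤ 1) * sawtooth ((+ (h ℕ.* μ)) ÷ℤ k) * sawtooth ((+ μ) ÷ℤ (φ p k ℕ.* k)))

tχ : ℕ → ℕ → ℕ → ℚ
tχ p h k = (Σℤ (φ p k ℕ.* k) (λ μ → (+ μ) ℤ.* legendre p μ ℤ.* (+ divℕ (h ℕ.* μ) k))) ÷ℤ φ p k

-- Write N = φ k · k = lcm(k, p). Since ((qhμ/qk)) = ((hμ/k)), ⌊qhμ/qk⌋ = ⌊hμ/k⌋ and χ has period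
-- p ∣ N, both sums for (qh, qk) run over m full blocks μ = jN + a of length N, where
-- φ(qk) · qk = m N. For s_χ, the sum of ((μ/mN)) over the m values of j collapses by the
-- distribution relation to m ((a/N)). For t_χ the summand over a block is a quadratic polynomial in j
-- whose linear and quadratic coefficients are multiples of Σ χ(a), Σ a χ(a) and Σ χ(a) ⌊ha/k⌋ over
-- a period; the first vanishes because χ is balanced, and the other two because p ≡ 1 (mod 4) makes
-- χ even, so that the reflection a ↦ N − a turns each of them into its own negative. Evenness is the
-- statement that −1 is a square mod p: pairing each x ∈ [1, (p−1)/2] with the y there such that
-- x y ≡ ±1 shows that the number of x with x² ≡ −1 is odd.

module Submission where

open import Algebra.Bundles using (CommutativeSemigroup)
open import Algebra.Structures using (IsCommutativeSemiring; IsCommutativeRing)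
open import Data.Bool using (Bool; true; false; T; _∨_; if_then_else_)
open import Data.Bool.ListAction using (any)
open import Data.Bool.Properties using (T-≡; ⇔→≡; ∨-zeroʳ)
open import Data.Empty using (⊥; ⊥-elim)
open import Data.Integer as ℤ using (ℤ; +_; -[1+_])
import Data.Integer.Properties as ℤP
open import Algebra.Properties.AbelianGroup ℤP.+-0-abelianGroup using (∙-cancelʳ)
import Data.Integer.Tactic.RingSolver as ℤ-Solver
open import Data.List using (upTo)
open import Data.List.Relation.Unary.Any.Properties using (any⁺; any⁻; applyUpTo⁺; applyUpTo⁻)
open import Data.Nat as ℕ using (ℕ; zero; suc; _+_; _*_; _∸_; _<_; _≤_; z≤n; s≤s; _≡ᵇ_; NonZero; _%_; _/_)
import Data.Nat.Coprimality as Coprime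
open import Data.Nat.Coprimality using (coprime-/gcd; coprime-divisor)
open import Data.Nat.DivMod using (/-congˡ; m*n/m*o≡n/o; m≡m%n+[m/n]*n; [m+kn]%n≡m%n; m%n<n; m<n⇒m%n≡m; m*n%n≡0; m*n/n≡m; m/n*n≡m; m<n⇒m/n≡0; +-distrib-/-∣ˡ; %-remove-+ˡ; n%n≡0; m%n%n≡m%n; %-distribˡ-+; %-distribˡ-*; m*n/o*n≡m/o; %-congʳ; %-congˡ; m%n*o≡m*o%[n*o]; n/n≡1; n/1≡n)
open import Data.Nat.Divisibility using (_∣_; _∤_; divides; _∣?_; >⇒∤; ∣-refl; ∣-trans; ∣-antisym; n∣m*n; m∣m*n; ∣m⇒∣m*n; m%n≡0⇒n∣m; n∣m⇒m%n≡0; *-cancelʳ-∣)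
open import Data.Nat.GCD using (gcd; gcd-greatest; gcd[m,n]∣m; gcd[m,n]∣n; gcd[m,n]≢0; n/gcd[m,n]≢0)
open import Data.Nat.Primality using (Prime; euclidsLemma; prime⇒nonZero; prime⇒nonTrivial; prime⇒irreducible)
import Data.Nat.Properties as ℕP
open import Data.Nat.Tactic.RingSolver using (solve-∀)
open import Data.Product using (∃; _×_; _,_; proj₁; proj₂)
open import Data.Rational as ℚ using (ℚ; mkℚ; ↥_; ↧_; ↧ₙ_; ½; 0ℚ; toℚᵘ)
import Data.Rational.Properties as ℚP
open import Data.Rational.Unnormalised as ℚᵘ using (mkℚᵘ; *≡*) renaming (_≃_ to _≃ᵘ_)
import Data.Rational.Unnormalised.Properties as ℚᵘP
open import Data.Sum using (_⊎_; inj₁; inj₂)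
open import Function using (_∘_; case_of_; Equivalence; mk⇔)
open import Relation.Binary.PropositionalEquality
open import Relation.Nullary using (yes; no)

open import Defs

open ≡-Reasoning

module SumProperties
  {A : Set} {add mul : A → A → A} {0# 1# : A}
  (isCommutativeSemiring : IsCommutativeSemiring _≡_ add mul 0# 1#)
  (Σ : ℕ → (ℕ → A) → A)
  (Σ-zero : ∀ f → Σ 0 f ≡ 0#)
  (Σ-suc : ∀ n f → Σ (suc n) f ≡ add (Σ n f) (f n))
  where

  private
    infixl 6 _⊕_
    infixl 7 _⊛_
    _⊕_ = add
    _⊛_ = mul

  open IsCommutativeSemiring isCommutativeSemiring
    using (+-assoc; +-comm; +-identityˡ; +-identityʳ; distribˡ; zeroʳ; +-isCommutativeSemigroup)
  private
    +-commutativeSemigroup : CommutativeSemigroup _ _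
    +-commutativeSemigroup = record { isCommutativeSemigroup = +-isCommutativeSemigroup }

  open import Algebra.Properties.CommutativeSemigroup +-commutativeSemigroup using (interchange)

  Σ-cong : ∀ n {f g : ℕ → A} → (∀ i → i < n → f i ≡ g i) → Σ n f ≡ Σ n g
  Σ-cong zero {f} {g} _ = trans (Σ-zero f) (sym (Σ-zero g))
  Σ-cong (suc n) {f} {g} f≗g = begin
    Σ (suc n) f  ≡⟨ Σ-suc n f ⟩
    Σ n f ⊕ f n  ≡⟨ cong₂ _⊕_ (Σ-cong n (λ i i<n → f≗g i (ℕP.m<n⇒m<1+n i<n))) (f≗g n ℕP.≤-refl) ⟩
    Σ n g ⊕ g n  ≡⟨ Σ-suc n g ⟨
    Σ (suc n) g  ∎

  Σ-0# : ∀ n → Σ n (λ _ → 0#) ≡ 0#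
  Σ-0# zero = Σ-zero _
  Σ-0# (suc n) = trans (Σ-suc n _) (trans (cong (_⊕ 0#) (Σ-0# n)) (+-identityʳ 0#))

  Σ-distrib-⊕ : ∀ n (f g : ℕ → A) → Σ n (λ i → f i ⊕ g i) ≡ Σ n f ⊕ Σ n g
  Σ-distrib-⊕ zero f g = begin
    Σ 0 _          ≡⟨ Σ-zero _ ⟩
    0#             ≡⟨ +-identityʳ 0# ⟨
    0# ⊕ 0#        ≡⟨ cong₂ _⊕_ (Σ-zero f) (Σ-zero g) ⟨
    Σ 0 f ⊕ Σ 0 g  ∎
  Σ-distrib-⊕ (suc n) f g = begin
    Σ (suc n) (λ i → f i ⊕ g i)          ≡⟨ Σ-suc n _ ⟩
    Σ n (λ i → f i ⊕ g i) ⊕ (f n ⊕ g n)  ≡⟨ cong (_⊕ (f n ⊕ g n)) (Σ-distrib-⊕ n f g) ⟩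
    (Σ n f ⊕ Σ n g) ⊕ (f n ⊕ g n)        ≡⟨ interchange _ _ _ _ ⟩
    (Σ n f ⊕ f n) ⊕ (Σ n g ⊕ g n)        ≡⟨ cong₂ _⊕_ (Σ-suc n f) (Σ-suc n g) ⟨
    Σ (suc n) f ⊕ Σ (suc n) g            ∎

  Σ-scaleˡ : ∀ n c (f : ℕ → A) → Σ n (λ i → c ⊛ f i) ≡ c ⊛ Σ n f
  Σ-scaleˡ zero c f = begin
    Σ 0 _       ≡⟨ Σ-zero _ ⟩
    0#          ≡⟨ zeroʳ c ⟨
    c ⊛ 0#      ≡⟨ cong (c ⊛_) (Σ-zero f) ⟨
    c ⊛ Σ 0 f   ∎
  Σ-scaleˡ (suc n) c f = begin
    Σ (suc n) (λ i → c ⊛ f i)      ≡⟨ Σ-suc n _ ⟩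
    Σ n (λ i → c ⊛ f i) ⊕ c ⊛ f n  ≡⟨ cong (_⊕ c ⊛ f n) (Σ-scaleˡ n c f) ⟩
    c ⊛ Σ n f ⊕ c ⊛ f n            ≡⟨ distribˡ c _ _ ⟨
    c ⊛ (Σ n f ⊕ f n)              ≡⟨ cong (c ⊛_) (Σ-suc n f) ⟨
    c ⊛ Σ (suc n) f                ∎

  Σ-split : ∀ m n (f : ℕ → A) → Σ (m + n) f ≡ Σ m f ⊕ Σ n (λ i → f (m + i))
  Σ-split m zero f = begin
    Σ (m + 0) f  ≡⟨ cong (λ l → Σ l f) (ℕP.+-identityʳ m) ⟩
    Σ m f        ≡⟨ +-identityʳ _ ⟨
    Σ m f ⊕ 0#   ≡⟨ cong (Σ m f ⊕_) (Σ-zero _) ⟨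
    Σ m f ⊕ Σ 0 (λ i → f (m + i)) ∎
  Σ-split m (suc n) f = begin
    Σ (m + suc n) f                                ≡⟨ cong (λ l → Σ l f) (ℕP.+-suc m n) ⟩
    Σ (suc (m + n)) f                              ≡⟨ Σ-suc _ f ⟩
    Σ (m + n) f ⊕ f (m + n)                        ≡⟨ cong (_⊕ f (m + n)) (Σ-split m n f) ⟩
    (Σ m f ⊕ Σ n (λ i → f (m + i))) ⊕ f (m + n)    ≡⟨ +-assoc _ _ _ ⟩
    Σ m f ⊕ (Σ n (λ i → f (m + i)) ⊕ f (m + n))    ≡⟨ cong (Σ m f ⊕_) (Σ-suc n _) ⟨
    Σ m f ⊕ Σ (suc n) (λ i → f (m + i))            ∎

  Σ-blocks : ∀ m N (f : ℕ → A) → Σ (m * N) f ≡ Σ m (λ j → Σ N (λ a → f (j * N + a)))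
  Σ-blocks zero N f = trans (Σ-zero f) (sym (Σ-zero _))
  Σ-blocks (suc m) N f = begin
    Σ (N + m * N) f                                  ≡⟨ cong (λ l → Σ l f) (ℕP.+-comm N (m * N)) ⟩
    Σ (m * N + N) f                                  ≡⟨ Σ-split (m * N) N f ⟩
    Σ (m * N) f ⊕ Σ N (λ a → f (m * N + a))          ≡⟨ cong (_⊕ Σ N (λ a → f (m * N + a))) (Σ-blocks m N f) ⟩
    Σ m (λ j → Σ N (λ a → f (j * N + a))) ⊕ Σ N (λ a → f (m * N + a)) ≡⟨ Σ-suc m _ ⟨
    Σ (suc m) (λ j → Σ N (λ a → f (j * N + a)))      ∎

  Σ-comm : ∀ m n (f : ℕ → ℕ → A) → Σ m (λ i → Σ n (f i)) ≡ Σ n (λ j → Σ m (λ i → f i j))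
  Σ-comm zero n f = begin
    Σ 0 _                     ≡⟨ Σ-zero _ ⟩
    0#                        ≡⟨ Σ-0# n ⟨
    Σ n (λ _ → 0#)            ≡⟨ Σ-cong n (λ j _ → Σ-zero _) ⟨
    Σ n (λ j → Σ 0 (λ i → f i j)) ∎
  Σ-comm (suc m) n f = begin
    Σ (suc m) (λ i → Σ n (f i))                          ≡⟨ Σ-suc m _ ⟩
    Σ m (λ i → Σ n (f i)) ⊕ Σ n (f m)                    ≡⟨ cong (_⊕ Σ n (f m)) (Σ-comm m n f) ⟩
    Σ n (λ j → Σ m (λ i → f i j)) ⊕ Σ n (f m)            ≡⟨ Σ-distrib-⊕ n _ _ ⟨
    Σ n (λ j → Σ m (λ i → f i j) ⊕ f m j)                ≡⟨ Σ-cong n (λ j _ → Σ-suc m _) ⟨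
    Σ n (λ j → Σ (suc m) (λ i → f i j))                  ∎

  Σ-sucˡ : ∀ n (f : ℕ → A) → Σ (suc n) f ≡ f 0 ⊕ Σ n (λ i → f (suc i))
  Σ-sucˡ n f = begin
    Σ (1 + n) f                        ≡⟨ Σ-split 1 n f ⟩
    Σ 1 f ⊕ Σ n (λ i → f (suc i))      ≡⟨ cong (_⊕ Σ n (λ i → f (suc i))) (trans (Σ-suc 0 f) (cong (_⊕ f 0) (Σ-zero f))) ⟩
    (0# ⊕ f 0) ⊕ Σ n (λ i → f (suc i)) ≡⟨ cong (_⊕ Σ n (λ i → f (suc i))) (+-identityˡ (f 0)) ⟩
    f 0 ⊕ Σ n (λ i → f (suc i))        ∎

  Σ-reverse : ∀ n (f : ℕ → A) → Σ n f ≡ Σ n (λ i → f (n ∸ suc i))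
  Σ-reverse zero f = trans (Σ-zero f) (sym (Σ-zero _))
  Σ-reverse (suc n) f = begin
    Σ (suc n) f                                ≡⟨ Σ-suc n f ⟩
    Σ n f ⊕ f n                                ≡⟨ cong (_⊕ f n) (Σ-reverse n f) ⟩
    Σ n (λ i → f (n ∸ suc i)) ⊕ f n            ≡⟨ +-comm _ _ ⟩
    f n ⊕ Σ n (λ i → f (n ∸ suc i))            ≡⟨ Σ-sucˡ n _ ⟨
    Σ (suc n) (λ i → f (suc n ∸ suc i))        ∎


Σℕ : ℕ → (ℕ → ℕ) → ℕ
Σℕ zero f = 0
Σℕ (suc n) f = Σℕ n f + f n

module ℕΣ = SumProperties ℕP.+-*-isCommutativeSemiring Σℕ (λ _ → refl) (λ _ _ → refl)
module ℤΣ = SumProperties ℤP.+-*-isCommutativeSemiring Σℤ (λ _ → refl) (λ _ _ → refl)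
module ℚΣ = SumProperties (IsCommutativeRing.isCommutativeSemiring ℚP.+-*-isCommutativeRing)
                          Σℚ (λ _ → refl) (λ _ _ → refl)

Σℕ-1 : ∀ n → Σℕ n (λ _ → 1) ≡ n
Σℕ-1 zero = refl
Σℕ-1 (suc n) = trans (cong (_+ 1) (Σℕ-1 n)) (ℕP.+-comm n 1)

Σℤ-pos : ∀ n (f : ℕ → ℕ) → Σℤ n (λ i → + f i) ≡ + Σℕ n f
Σℤ-pos zero f = refl
Σℤ-pos (suc n) f = cong (ℤ._+ + f n) (Σℤ-pos n f)

Σℤ-const : ∀ n c → Σℤ n (λ _ → c) ≡ + n ℤ.* c
Σℤ-const zero c = sym (ℤP.*-zeroˡ c)
Σℤ-const (suc n) c = begin
  Σℤ n (λ _ → c) ℤ.+ c      ≡⟨ cong₂ ℤ._+_ (Σℤ-const n c) (sym (ℤP.*-identityˡ c)) ⟩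
  + n ℤ.* c ℤ.+ + 1 ℤ.* c   ≡⟨ ℤP.*-distribʳ-+ c (+ n) (+ 1) ⟨
  (+ n ℤ.+ + 1) ℤ.* c       ≡⟨ cong (λ m → + m ℤ.* c) (ℕP.+-comm n 1) ⟩
  + suc n ℤ.* c             ∎

Σℕ²-symmetric : ∀ n (f : ℕ → ℕ → ℕ) → (∀ i j → f i j ≡ f j i) →
                Σℕ n (λ i → Σℕ n (f i)) ≡ Σℕ n (λ i → f i i) + 2 * Σℕ n (λ i → Σℕ i (f i))
Σℕ²-symmetric zero f _ = refl
Σℕ²-symmetric (suc n) f f-sym = begin
  Σℕ n (λ i → Σℕ n (f i) + f i n) + (Σℕ n (f n) + f n n)
    ≡⟨ cong (_+ (Σℕ n (f n) + f n n)) (trans (ℕΣ.Σ-distrib-⊕ n _ _)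
         (cong₂ _+_ (Σℕ²-symmetric n f f-sym) (ℕΣ.Σ-cong n (λ i _ → f-sym i n)))) ⟩
  (Σℕ n (λ i → f i i) + 2 * L) + Σℕ n (f n) + (Σℕ n (f n) + f n n)
    ≡⟨ rearrange (Σℕ n (λ i → f i i)) L (Σℕ n (f n)) (f n n) ⟩
  (Σℕ n (λ i → f i i) + f n n) + 2 * (L + Σℕ n (f n)) ∎
  where
  L = Σℕ n (λ i → Σℕ i (f i))
  rearrange : ∀ D T R d → (D + 2 * T) + R + (R + d) ≡ (D + d) + 2 * (T + R)
  rearrange = solve-∀

𝟙 : Bool → ℕ
𝟙 true = 1
𝟙 false = 0

count : ℕ → (ℕ → Bool) → ℕ
count n b = Σℕ n (λ i → 𝟙 (b i))

≡ᵇ⇒≡ : ∀ {m n} → (m ≡ᵇ n) ≡ true → m ≡ n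
≡ᵇ⇒≡ {m} {n} eq = ℕP.≡ᵇ⇒≡ m n (subst T (sym eq) _)

≡ᵇ-refl : ∀ n → (n ≡ᵇ n) ≡ true
≡ᵇ-refl zero = refl
≡ᵇ-refl (suc n) = ≡ᵇ-refl n

≢⇒≡ᵇ-false : ∀ {m n} → m ≢ n → (m ≡ᵇ n) ≡ false
≢⇒≡ᵇ-false {m} {n} m≢n with m ≡ᵇ n in eq
... | true = ⊥-elim (m≢n (≡ᵇ⇒≡ eq))
... | false = refl

≡⇒≡ᵇ-true : ∀ {m n} → m ≡ n → (m ≡ᵇ n) ≡ true
≡⇒≡ᵇ-true {m} refl = ≡ᵇ-refl m

≡ᵇ-cong-⇔ : ∀ {a b c d} → (a ≡ b → c ≡ d) → (c ≡ d → a ≡ b) → (a ≡ᵇ b) ≡ (c ≡ᵇ d)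
≡ᵇ-cong-⇔ to from = ⇔→≡ {z = true} (mk⇔ (≡⇒≡ᵇ-true ∘ to ∘ ≡ᵇ⇒≡) (≡⇒≡ᵇ-true ∘ from ∘ ≡ᵇ⇒≡))

≡ᵇ-comm : ∀ m n → (m ≡ᵇ n) ≡ (n ≡ᵇ m)
≡ᵇ-comm m n with m ℕP.≟ n
... | yes refl = refl
... | no m≢n = trans (≢⇒≡ᵇ-false m≢n) (sym (≢⇒≡ᵇ-false (m≢n ∘ sym)))

count-none : ∀ n (b : ℕ → Bool) → (∀ i → i < n → b i ≡ false) → count n b ≡ 0
count-none n b none = trans (ℕΣ.Σ-cong n (λ i i<n → cong 𝟙 (none i i<n))) (ℕΣ.Σ-0# n)

count-≡ᵇ : ∀ n y → y < n → count n (_≡ᵇ y) ≡ 1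
count-≡ᵇ (suc n) y y<1+n with ℕP.m≤n⇒m<n∨m≡n (ℕP.≤-pred y<1+n)
... | inj₁ y<n = cong₂ _+_ (count-≡ᵇ n y y<n) (cong 𝟙 (≢⇒≡ᵇ-false (λ n≡y → ℕP.<-irrefl (sym n≡y) y<n)))
... | inj₂ refl = cong₂ _+_ (count-none y (_≡ᵇ y) (λ i i<y → ≢⇒≡ᵇ-false (λ i≡y → ℕP.<-irrefl i≡y i<y)))
                            (cong 𝟙 (≡ᵇ-refl y))

count>0⇒∃ : ∀ n (b : ℕ → Bool) → 0 < count n b → ∃ λ i → i < n × b i ≡ true
count>0⇒∃ (suc n) b pos with b n in bn
... | true = n , ℕP.≤-refl , bn
... | false with count>0⇒∃ n b (subst (0 <_) (ℕP.+-identityʳ _) pos)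
...   | i , i<n , bi = i , ℕP.m<n⇒m<1+n i<n , bi

AtMostOne : ℕ → (ℕ → Bool) → Set
AtMostOne n b = ∀ i j → i < n → j < n → b i ≡ true → b j ≡ true → i ≡ j

count≤1 : ∀ n (b : ℕ → Bool) → AtMostOne n b → count n b ≤ 1
count≤1 zero b _ = z≤n
count≤1 (suc n) b unique with b n in bn
... | false = subst (_≤ 1) (sym (ℕP.+-identityʳ _))
                (count≤1 n b (λ i j i<n j<n → unique i j (ℕP.m<n⇒m<1+n i<n) (ℕP.m<n⇒m<1+n j<n)))
... | true = ℕP.≤-reflexive (cong (_+ 1) (count-none n b others-false))
  where
  others-false : ∀ i → i < n → b i ≡ false
  others-false i i<n with b i in bi
  ... | false = refl
  ... | true = ⊥-elim (ℕP.<-irrefl (unique i n (ℕP.m<n⇒m<1+n i<n) ℕP.≤-refl bi bn) i<n)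

term≤Σℕ : ∀ n (f : ℕ → ℕ) i → i < n → f i ≤ Σℕ n f
term≤Σℕ (suc n) f i i<1+n with ℕP.m≤n⇒m<n∨m≡n (ℕP.≤-pred i<1+n)
... | inj₁ i<n = ℕP.≤-trans (term≤Σℕ n f i i<n) (ℕP.m≤m+n _ _)
... | inj₂ refl = ℕP.m≤n+m _ _

count≡1 : ∀ n (b : ℕ → Bool) → AtMostOne n b → ∀ i → i < n → b i ≡ true → count n b ≡ 1
count≡1 n b unique i i<n bi =
  ℕP.≤-antisym (count≤1 n b unique) (subst (_≤ count n b) (cong 𝟙 bi) (term≤Σℕ n (λ i → 𝟙 (b i)) i i<n))

Σℕ≤n : ∀ n (u : ℕ → ℕ) → (∀ c → c < n → u c ≤ 1) → Σℕ n u ≤ n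
Σℕ≤n zero u _ = z≤n
Σℕ≤n (suc n) u u≤1 = ℕP.≤-trans (ℕP.+-mono-≤ (Σℕ≤n n u (λ c c<n → u≤1 c (ℕP.m<n⇒m<1+n c<n))) (u≤1 n ℕP.≤-refl))
                                (ℕP.≤-reflexive (ℕP.+-comm n 1))

Σℕ≤n-tight : ∀ n (u : ℕ → ℕ) → Σℕ n u ≡ n → (∀ c → c < n → u c ≤ 1) → ∀ c → c < n → u c ≡ 1
Σℕ≤n-tight (suc n) u total u≤1 c c<1+n = case ℕP.m≤n⇒m<n∨m≡n (ℕP.≤-pred c<1+n) of λ where
    (inj₁ c<n) → Σℕ≤n-tight n u init≡n u≤1ᵢ c c<n
    (inj₂ c≡n) → subst (λ c → u c ≡ 1) (sym c≡n) last≡1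
  where
  u≤1ᵢ : ∀ c → c < n → u c ≤ 1
  u≤1ᵢ c c<n = u≤1 c (ℕP.m<n⇒m<1+n c<n)
  last≡1 : u n ≡ 1
  last≡1 = ℕP.≤-antisym (u≤1 n ℕP.≤-refl) (ℕP.+-cancelˡ-≤ n 1 (u n)
    (ℕP.≤-trans (ℕP.≤-reflexive (trans (ℕP.+-comm n 1) (sym total))) (ℕP.+-monoˡ-≤ (u n) (Σℕ≤n n u u≤1ᵢ))))
  init≡n : Σℕ n u ≡ n
  init≡n = ℕP.+-cancelʳ-≡ 1 (Σℕ n u) n (trans (cong (λ m → Σℕ n u + m) (sym last≡1)) (trans total (ℕP.+-comm 1 n)))

count-two : ∀ n (b : ℕ → Bool) y z → y < n → z < n → y ≢ z → b y ≡ true → b z ≡ true →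
            (∀ x → x < n → b x ≡ true → x ≡ y ⊎ x ≡ z) → count n b ≡ 2
count-two n b y z y<n z<n y≢z by bz only = begin
  count n b                                   ≡⟨ ℕΣ.Σ-cong n split ⟩
  Σℕ n (λ x → 𝟙 (x ≡ᵇ y) + 𝟙 (x ≡ᵇ z))        ≡⟨ ℕΣ.Σ-distrib-⊕ n _ _ ⟩
  count n (_≡ᵇ y) + count n (_≡ᵇ z)           ≡⟨ cong₂ _+_ (count-≡ᵇ n y y<n) (count-≡ᵇ n z z<n) ⟩
  2                                           ∎
  where
  split : ∀ x → x < n → 𝟙 (b x) ≡ 𝟙 (x ≡ᵇ y) + 𝟙 (x ≡ᵇ z)
  split x x<n with x ℕP.≟ y | x ℕP.≟ z
  ... | yes refl | yes refl = ⊥-elim (y≢z refl)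
  ... | yes refl | no x≢z = trans (cong 𝟙 by) (sym (cong₂ (λ u v → 𝟙 u + 𝟙 v) (≡ᵇ-refl x) (≢⇒≡ᵇ-false x≢z)))
  ... | no x≢y | yes refl = trans (cong 𝟙 bz) (sym (cong₂ (λ u v → 𝟙 u + 𝟙 v) (≢⇒≡ᵇ-false x≢y) (≡ᵇ-refl x)))
  ... | no x≢y | no x≢z with b x in bx
  ...   | true = case only x x<n bx of λ where
          (inj₁ x≡y) → ⊥-elim (x≢y x≡y)
          (inj₂ x≡z) → ⊥-elim (x≢z x≡z)
  ...   | false = sym (cong₂ (λ u v → 𝟙 u + 𝟙 v) (≢⇒≡ᵇ-false x≢y) (≢⇒≡ᵇ-false x≢z))

modℕ≡% : ∀ a n .{{_ : NonZero n}} → modℕ a n ≡ a % n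
modℕ≡% a (suc n) = refl

divℕ≡/ : ∀ a n .{{_ : NonZero n}} → divℕ a n ≡ a / n
divℕ≡/ a (suc n) = refl

∣∧<⇒≡0 : ∀ {p n} → p ∣ n → n < p → n ≡ 0
∣∧<⇒≡0 {n = zero} _ _ = refl
∣∧<⇒≡0 {n = suc n} p∣n n<p = ⊥-elim (>⇒∤ n<p p∣n)

∣∧<2*⇒≡0⊎≡ : ∀ {p n} → p ∣ n → n < p + p → n ≡ 0 ⊎ n ≡ p
∣∧<2*⇒≡0⊎≡ (divides zero n≡0) _ = inj₁ n≡0
∣∧<2*⇒≡0⊎≡ {p} (divides 1 n≡p) _ = inj₂ (trans n≡p (ℕP.+-identityʳ p))
∣∧<2*⇒≡0⊎≡ {p} (divides (suc (suc q)) refl) n<2p =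
  ⊥-elim (ℕP.<⇒≱ n<2p (ℕP.+-monoʳ-≤ p (ℕP.m≤m+n p (q * p))))

%≡%⇒∣∸ : ∀ a b n .{{_ : NonZero n}} → a % n ≡ b % n → n ∣ b ∸ a
%≡%⇒∣∸ a b n eq = divides (b / n ∸ a / n) (begin
  b ∸ a                                          ≡⟨ cong₂ _∸_ (m≡m%n+[m/n]*n b n) (m≡m%n+[m/n]*n a n) ⟩
  (b % n + b / n * n) ∸ (a % n + a / n * n)      ≡⟨ cong (λ r → (b % n + b / n * n) ∸ (r + a / n * n)) eq ⟩
  (b % n + b / n * n) ∸ (b % n + a / n * n)      ≡⟨ ℕP.[m+n]∸[m+o]≡n∸o (b % n) _ _ ⟩
  b / n * n ∸ a / n * n                          ≡⟨ ℕP.*-distribʳ-∸ n (b / n) (a / n) ⟨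
  (b / n ∸ a / n) * n                            ∎)

m²∸n²≡[m+n][m∸n] : ∀ m n → n ≤ m → m * m ∸ n * n ≡ (m + n) * (m ∸ n)
m²∸n²≡[m+n][m∸n] m n n≤m = begin
  m * m ∸ n * n                     ≡⟨ cong (λ x → x * x ∸ n * n) m≡n+d ⟩
  (n + d) * (n + d) ∸ n * n         ≡⟨ cong (_∸ n * n) (expand n d) ⟩
  n * n + (n + d + n) * d ∸ n * n   ≡⟨ ℕP.m+n∸m≡n (n * n) _ ⟩
  (n + d + n) * d                   ≡⟨ cong (λ x → (x + n) * d) m≡n+d ⟨
  (m + n) * (m ∸ n)                 ∎
  where
  d = m ∸ n
  m≡n+d : m ≡ n + d
  m≡n+d = sym (ℕP.m+[n∸m]≡n n≤m)
  expand : ∀ n d → (n + d) * (n + d) ≡ n * n + (n + d + n) * d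
  expand = solve-∀

+≡0-unique : ∀ {u u′} v n .{{_ : NonZero n}} → (u + v) % n ≡ 0 → (u′ + v) % n ≡ 0 → u % n ≡ u′ % n
+≡0-unique {u} {u′} v n u+v≡0 u′+v≡0 = begin
  u % n                          ≡⟨ m%n%n≡m%n u n ⟨
  (u % n) % n                    ≡⟨ cong (λ r → r % n) (ℕP.+-identityʳ (u % n)) ⟨
  (u % n + 0) % n                ≡⟨ cong (λ r → (u % n + r) % n) v+u′≡0 ⟨
  (u % n + (v + u′) % n) % n     ≡⟨ %-distribˡ-+ u (v + u′) n ⟨
  (u + (v + u′)) % n             ≡⟨ cong (_% n) (ℕP.+-assoc u v u′) ⟨
  (u + v + u′) % n               ≡⟨ %-distribˡ-+ (u + v) u′ n ⟩
  ((u + v) % n + u′ % n) % n     ≡⟨ cong (λ r → (r + u′ % n) % n) u+v≡0 ⟩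
  (u′ % n) % n                   ≡⟨ m%n%n≡m%n u′ n ⟩
  u′ % n                         ∎
  where
  v+u′≡0 : (v + u′) % n ≡ 0
  v+u′≡0 = trans (cong (_% n) (ℕP.+-comm v u′)) u′+v≡0

*-cong-mod : ∀ {x x′ y y′} n .{{_ : NonZero n}} → x % n ≡ x′ % n → y % n ≡ y′ % n → (x * y) % n ≡ (x′ * y′) % n
*-cong-mod {x} {x′} {y} {y′} n x≡x′ y≡y′ = begin
  (x * y) % n                 ≡⟨ %-distribˡ-* x y n ⟩
  ((x % n) * (y % n)) % n     ≡⟨ cong₂ (λ u v → (u * v) % n) x≡x′ y≡y′ ⟩
  ((x′ % n) * (y′ % n)) % n   ≡⟨ %-distribˡ-* x′ y′ n ⟨
  (x′ * y′) % n               ∎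

+-cong-mod : ∀ {x x′ y y′} n .{{_ : NonZero n}} → x % n ≡ x′ % n → y % n ≡ y′ % n → (x + y) % n ≡ (x′ + y′) % n
+-cong-mod {x} {x′} {y} {y′} n x≡x′ y≡y′ = begin
  (x + y) % n                 ≡⟨ %-distribˡ-+ x y n ⟩
  ((x % n) + (y % n)) % n     ≡⟨ cong₂ (λ u v → (u + v) % n) x≡x′ y≡y′ ⟩
  ((x′ % n) + (y′ % n)) % n   ≡⟨ %-distribˡ-+ x′ y′ n ⟨
  (x′ + y′) % n               ∎

module ModPrime (p : ℕ) (p-prime : Prime p) where

  instance
    p≢0 : NonZero p
    p≢0 = prime⇒nonZero p-prime

  1<p : 1 < p
  1<p = ℕ.nonTrivial⇒n>1 p {{prime⇒nonTrivial p-prime}}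

  0<p : 0 < p
  0<p = ℕP.<-trans (s≤s z≤n) 1<p

  ∤-between : ∀ {x} → 0 < x → x < p → p ∤ x
  ∤-between 0<x x<p p∣x = ℕP.<-irrefl (sym (∣∧<⇒≡0 p∣x x<p)) 0<x

  square≡0⇒≡0 : ∀ {x} → x < p → (x * x) % p ≡ 0 → x ≡ 0
  square≡0⇒≡0 {x} x<p x²≡0 with euclidsLemma x x p-prime (m%n≡0⇒n∣m _ p x²≡0)
  ... | inj₁ p∣x = ∣∧<⇒≡0 p∣x x<p
  ... | inj₂ p∣x = ∣∧<⇒≡0 p∣x x<p

  square-roots≤ : ∀ {x y} → x < p → y ≤ x → (x * x) % p ≡ (y * y) % p → x ≡ y ⊎ x + y ≡ p
  square-roots≤ {x} {y} x<p y≤x x²≡y² with euclidsLemma (x + y) (x ∸ y) p-prime p∣x²∸y²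
    where
    p∣x²∸y² : p ∣ (x + y) * (x ∸ y)
    p∣x²∸y² = subst (p ∣_) (m²∸n²≡[m+n][m∸n] x y y≤x) (%≡%⇒∣∸ (y * y) (x * x) p (sym x²≡y²))
  ... | inj₂ p∣x∸y = inj₁ (ℕP.≤-antisym (ℕP.m∸n≡0⇒m≤n (∣∧<⇒≡0 p∣x∸y (ℕP.≤-<-trans (ℕP.m∸n≤m x y) x<p))) y≤x)
  ... | inj₁ p∣x+y with ∣∧<2*⇒≡0⊎≡ p∣x+y (ℕP.+-mono-< x<p (ℕP.≤-<-trans y≤x x<p))
  ...   | inj₂ x+y≡p = inj₂ x+y≡p
  ...   | inj₁ x+y≡0 = inj₁ (trans (ℕP.m+n≡0⇒m≡0 x x+y≡0) (sym (ℕP.m+n≡0⇒n≡0 x x+y≡0)))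

  square-roots : ∀ {x y} → x < p → y < p → (x * x) % p ≡ (y * y) % p → x ≡ y ⊎ x + y ≡ p
  square-roots {x} {y} x<p y<p x²≡y² with ℕP.≤-total y x
  ... | inj₁ y≤x = square-roots≤ x<p y≤x x²≡y²
  ... | inj₂ x≤y with square-roots≤ y<p x≤y (sym x²≡y²)
  ...   | inj₁ y≡x = inj₁ (sym y≡x)
  ...   | inj₂ y+x≡p = inj₂ (trans (ℕP.+-comm x y) y+x≡p)

  [p∸y]²≡y² : ∀ y → y ≤ p → ((p ∸ y) * (p ∸ y)) % p ≡ (y * y) % p
  [p∸y]²≡y² y y≤p = begin
    (z * z) % p                               ≡⟨ [m+kn]%n≡m%n (z * z) (y + y) p ⟨
    (z * z + (y + y) * p) % p                 ≡⟨ cong (λ w → (z * z + (y + y) * w) % p) p≡y+z ⟩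
    (z * z + (y + y) * (y + z)) % p           ≡⟨ cong (_% p) (expand y z) ⟩
    (y * y + (y + z) * (y + z)) % p           ≡⟨ cong (λ w → (y * y + w * w) % p) p≡y+z ⟨
    (y * y + p * p) % p                       ≡⟨ [m+kn]%n≡m%n (y * y) p p ⟩
    (y * y) % p                               ∎
    where
    z = p ∸ y
    p≡y+z : p ≡ y + z
    p≡y+z = sym (ℕP.m+[n∸m]≡n y≤p)
    expand : ∀ y z → z * z + (y + y) * (y + z) ≡ y * y + (y + z) * (y + z)
    expand = solve-∀

  *-cancelˡ-≤-mod : ∀ e {b c} → p ∤ e → b < p → c ≤ b → (e * b) % p ≡ (e * c) % p → b ≡ c
  *-cancelˡ-≤-mod e {b} {c} p∤e b<p c≤b eb≡ec with euclidsLemma e (b ∸ c) p-prime p∣e[b∸c]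
    where
    p∣e[b∸c] : p ∣ e * (b ∸ c)
    p∣e[b∸c] = subst (p ∣_) (sym (ℕP.*-distribˡ-∸ e b c)) (%≡%⇒∣∸ (e * c) (e * b) p (sym eb≡ec))
  ... | inj₁ p∣e = ⊥-elim (p∤e p∣e)
  ... | inj₂ p∣b∸c = ℕP.≤-antisym (ℕP.m∸n≡0⇒m≤n (∣∧<⇒≡0 p∣b∸c (ℕP.≤-<-trans (ℕP.m∸n≤m b c) b<p))) c≤b

  *-cancelˡ-mod : ∀ e {b c} → p ∤ e → b < p → c < p → (e * b) % p ≡ (e * c) % p → b ≡ c
  *-cancelˡ-mod e {b} {c} p∤e b<p c<p eb≡ec with ℕP.≤-total c b
  ... | inj₁ c≤b = *-cancelˡ-≤-mod e p∤e b<p c≤b eb≡ec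
  ... | inj₂ b≤c = sym (*-cancelˡ-≤-mod e p∤e c<p b≤c (sym eb≡ec))

  ∤-* : ∀ {m n} → p ∤ m → p ∤ n → p ∤ m * n
  ∤-* {m} {n} p∤m p∤n p∣mn with euclidsLemma m n p-prime p∣mn
  ... | inj₁ p∣m = p∤m p∣m
  ... | inj₂ p∣n = p∤n p∣n

χ-value : Bool → Bool → ℤ
χ-value true _ = + 0
χ-value false true = + 1
χ-value false false = -[1+ 0 ]

legendre-view : ∀ p a → legendre p a ≡ χ-value (modℕ a p ≡ᵇ 0) (isSquareMod p a)
legendre-view p a with modℕ a p ≡ᵇ 0
... | true = refl
... | false with isSquareMod p a
...   | true = refl
...   | false = refl

module Legendre (p : ℕ) (p-prime : Prime p) (p≡1[4] : p % 4 ≡ 1) where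

  open ModPrime p p-prime public

  legendre≡χ-value : ∀ a → legendre p a ≡ χ-value (a % p ≡ᵇ 0) (isSquareMod p a)
  legendre≡χ-value a = trans (legendre-view p a) (cong (λ r → χ-value (r ≡ᵇ 0) (isSquareMod p a)) (modℕ≡% a p))

  legendre-mod : ∀ {a b} → a % p ≡ b % p → legendre p a ≡ legendre p b
  legendre-mod {a} {b} a≡b = begin
    legendre p a                                ≡⟨ legendre-view p a ⟩
    χ-value (modℕ a p ≡ᵇ 0) (isSquareMod p a)   ≡⟨ cong (λ r → χ-value (r ≡ᵇ 0) (any (λ x → modℕ (x * x) p ≡ᵇ r) (upTo p))) modℕ-a≡b ⟩
    χ-value (modℕ b p ≡ᵇ 0) (isSquareMod p b)   ≡⟨ legendre-view p b ⟨
    legendre p b                                ∎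
    where
    modℕ-a≡b : modℕ a p ≡ modℕ b p
    modℕ-a≡b = trans (modℕ≡% a p) (trans a≡b (sym (modℕ≡% b p)))

  legendre-∣ : ∀ {a} → p ∣ a → legendre p a ≡ + 0
  legendre-∣ {a} p∣a = trans (legendre≡χ-value a) (cong (λ r → χ-value (r ≡ᵇ 0) (isSquareMod p a)) (n∣m⇒m%n≡0 a p p∣a))

  isSquareMod⇒root : ∀ {a} → isSquareMod p a ≡ true → ∃ λ y → y < p × (y * y) % p ≡ a % p
  isSquareMod⇒root {a} square with applyUpTo⁻ (λ x → x) (any⁻ _ (upTo p) (Equivalence.from T-≡ square))
  ... | y , y<p , y²≡a = y , y<p , subst₂ _≡_ (modℕ≡% (y * y) p) (modℕ≡% a p) (ℕP.≡ᵇ⇒≡ _ _ y²≡a)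

  root⇒isSquareMod : ∀ {a y} → y < p → (y * y) % p ≡ a % p → isSquareMod p a ≡ true
  root⇒isSquareMod {a} {y} y<p y²≡a = Equivalence.to T-≡
    (any⁺ _ (applyUpTo⁺ (λ x → x) (ℕP.≡⇒≡ᵇ _ _ (subst₂ _≡_ (sym (modℕ≡% (y * y) p)) (sym (modℕ≡% a p)) y²≡a)) y<p))

  roots : ℕ → ℕ
  roots a = count p (λ x → (x * x) % p ≡ᵇ a % p)

  roots-zero : ∀ {a} → a % p ≡ 0 → roots a ≡ 1
  roots-zero {a} a≡0 = trans (ℕΣ.Σ-cong p only-0) (count-≡ᵇ p 0 0<p)
    where
    only-0 : ∀ x → x < p → 𝟙 ((x * x) % p ≡ᵇ a % p) ≡ 𝟙 (x ≡ᵇ 0)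
    only-0 x x<p = cong 𝟙 (trans (cong ((x * x) % p ≡ᵇ_) a≡0)
                                  (≡ᵇ-cong-⇔ (square≡0⇒≡0 x<p) (λ { refl → m<n⇒m%n≡m 0<p })))

  roots-nonsquare : ∀ {a} → isSquareMod p a ≡ false → roots a ≡ 0
  roots-nonsquare {a} nonsquare = count-none p _ (λ x x<p → ≢⇒≡ᵇ-false (λ x²≡a →
    case trans (sym nonsquare) (root⇒isSquareMod x<p x²≡a) of λ ()))

  H : ℕ
  H = 2 * (p / 4)

  p≡1+2H : p ≡ suc (2 * H)
  p≡1+2H = trans (m≡m%n+[m/n]*n p 4) (trans (cong (_+ p / 4 * 4) p≡1[4]) (cong suc (double-double (p / 4))))
    where
    double-double : ∀ t → t * 4 ≡ 2 * (2 * t)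
    double-double = solve-∀

  2*≢p : ∀ y → 2 * y ≢ p
  2*≢p y 2y≡p = ℕP.even≢odd y H (trans 2y≡p p≡1+2H)

  roots-square : ∀ {a} → a % p ≢ 0 → isSquareMod p a ≡ true → roots a ≡ 2
  roots-square {a} a≢0 square with isSquareMod⇒root square
  ... | y , y<p , y²≡a = count-two p _ y z y<p z<p y≢z (≡⇒≡ᵇ-true y²≡a) (≡⇒≡ᵇ-true z²≡a) only-y-z
    where
    z = p ∸ y
    y≢0 : y ≢ 0
    y≢0 refl = a≢0 (trans (sym y²≡a) (m<n⇒m%n≡m 0<p))
    z<p : z < p
    z<p = ℕP.∸-monoʳ-< {p} {y} {0} (ℕP.n≢0⇒n>0 y≢0) (ℕP.<⇒≤ y<p)
    y≢z : y ≢ z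
    y≢z y≡z = 2*≢p y (trans (cong (λ w → y + w) (trans (ℕP.+-identityʳ y) y≡z)) (ℕP.m+[n∸m]≡n (ℕP.<⇒≤ y<p)))
    z²≡a : (z * z) % p ≡ a % p
    z²≡a = trans ([p∸y]²≡y² y (ℕP.<⇒≤ y<p)) y²≡a
    only-y-z : ∀ x → x < p → ((x * x) % p ≡ᵇ a % p) ≡ true → x ≡ y ⊎ x ≡ z
    only-y-z x x<p x²≡a with square-roots x<p y<p (trans (≡ᵇ⇒≡ x²≡a) (sym y²≡a))
    ... | inj₁ x≡y = inj₁ x≡y
    ... | inj₂ x+y≡p = inj₂ (trans (sym (ℕP.m+n∸n≡m x y)) (cong (_∸ y) x+y≡p))

  legendre≡roots-1 : ∀ a → legendre p a ≡ + roots a ℤ.- + 1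
  legendre≡roots-1 a = trans (legendre≡χ-value a) (by-cases (a % p ≡ᵇ 0) refl (isSquareMod p a) refl)
    where
    by-cases : ∀ z → (a % p ≡ᵇ 0) ≡ z → ∀ s → isSquareMod p a ≡ s → χ-value z s ≡ + roots a ℤ.- + 1
    by-cases true a≡0 _ _ = cong (λ r → + r ℤ.- + 1) (sym (roots-zero (≡ᵇ⇒≡ a≡0)))
    by-cases false _ false nonsquare = cong (λ r → + r ℤ.- + 1) (sym (roots-nonsquare nonsquare))
    by-cases false a≢0 true square =
      cong (λ r → + r ℤ.- + 1) (sym (roots-square (λ a≡0 → case trans (sym a≢0) (≡⇒≡ᵇ-true a≡0) of λ ()) square))

  CompleteResidues : (ℕ → ℕ) → Set
  CompleteResidues g = ∀ c → c < p → count p (λ b → g b % p ≡ᵇ c) ≡ 1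

  Σ-legendre-complete : ∀ g → CompleteResidues g → Σℤ p (λ b → legendre p (g b)) ≡ + 0
  Σ-legendre-complete g complete = begin
    Σℤ p (λ b → legendre p (g b))                        ≡⟨ ℤΣ.Σ-cong p (λ b _ → legendre≡roots-1 (g b)) ⟩
    Σℤ p (λ b → + roots (g b) ℤ.- + 1)                   ≡⟨ ℤΣ.Σ-distrib-⊕ p _ _ ⟩
    Σℤ p (λ b → + roots (g b)) ℤ.+ Σℤ p (λ _ → ℤ.- + 1)  ≡⟨ cong₂ ℤ._+_ (Σℤ-pos p (roots ∘ g)) (Σℤ-const p (ℤ.- + 1)) ⟩
    + Σℕ p (roots ∘ g) ℤ.+ + p ℤ.* ℤ.- + 1               ≡⟨ cong (λ n → + n ℤ.+ + p ℤ.* ℤ.- + 1) Σroots≡p ⟩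
    + p ℤ.+ + p ℤ.* ℤ.- + 1                              ≡⟨ x+x*-1≡0 (+ p) ⟩
    + 0                                                  ∎
    where
    x+x*-1≡0 : ∀ x → x ℤ.+ x ℤ.* ℤ.- + 1 ≡ + 0
    x+x*-1≡0 = ℤ-Solver.solve-∀
    Σroots≡p : Σℕ p (roots ∘ g) ≡ p
    Σroots≡p = begin
      Σℕ p (λ b → count p (λ x → (x * x) % p ≡ᵇ g b % p))  ≡⟨ ℕΣ.Σ-comm p p _ ⟩
      Σℕ p (λ x → count p (λ b → (x * x) % p ≡ᵇ g b % p))  ≡⟨ ℕΣ.Σ-cong p (λ x _ → trans
                                                                (ℕΣ.Σ-cong p (λ b _ → cong 𝟙 (≡ᵇ-comm _ (g b % p))))
                                                                (complete _ (m%n<n (x * x) p))) ⟩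
      Σℕ p (λ _ → 1)                                       ≡⟨ Σℕ-1 p ⟩
      p                                                    ∎

  id-complete : CompleteResidues (λ b → b)
  id-complete c c<p = trans (ℕΣ.Σ-cong p (λ b b<p → cong (λ r → 𝟙 (r ≡ᵇ c)) (m<n⇒m%n≡m b<p))) (count-≡ᵇ p c c<p)

  *-complete : ∀ e → p ∤ e → CompleteResidues (e *_)
  *-complete e p∤e = Σℕ≤n-tight p hits total hits≤1
    where
    hits : ℕ → ℕ
    hits c = count p (λ b → (e * b) % p ≡ᵇ c)
    hits≤1 : ∀ c → c < p → hits c ≤ 1
    hits≤1 c _ = count≤1 p _ (λ i j i<p j<p ei ej → *-cancelˡ-mod e p∤e i<p j<p (trans (≡ᵇ⇒≡ ei) (sym (≡ᵇ⇒≡ ej))))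
    total : Σℕ p hits ≡ p
    total = begin
      Σℕ p hits                                       ≡⟨ ℕΣ.Σ-comm p p _ ⟩
      Σℕ p (λ b → count p (λ c → (e * b) % p ≡ᵇ c))   ≡⟨ ℕΣ.Σ-cong p (λ b _ → trans
                                                           (ℕΣ.Σ-cong p (λ c _ → cong 𝟙 (≡ᵇ-comm ((e * b) % p) c)))
                                                           (count-≡ᵇ p _ (m%n<n (e * b) p))) ⟩
      Σℕ p (λ _ → 1)                                  ≡⟨ Σℕ-1 p ⟩
      p                                               ∎

  Σ-legendre : Σℤ p (legendre p) ≡ + 0
  Σ-legendre = Σ-legendre-complete (λ b → b) id-complete

  Σ-legendre-* : ∀ e → p ∤ e → Σℤ p (λ b → legendre p (e * b)) ≡ + 0
  Σ-legendre-* e p∤e = Σ-legendre-complete (e *_) (*-complete e p∤e)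

  ≤H⇒<p : ∀ {x} → x ≤ H → x < p
  ≤H⇒<p {x} x≤H = ℕP.≤-trans (s≤s (ℕP.≤-trans x≤H (ℕP.m≤n*m H 2))) (ℕP.≤-reflexive (sym p≡1+2H))

  0<H : 0 < H
  0<H with H in H≡
  ... | suc _ = s≤s z≤n
  ... | zero = ⊥-elim (ℕP.<-irrefl (sym (trans p≡1+2H (cong (λ h → suc (2 * h)) H≡))) 1<p)

  p∸[1+H]≡H : p ∸ suc H ≡ H
  p∸[1+H]≡H = trans (cong (_∸ suc H) p≡1+2H) (trans (cong (λ t → H + t ∸ H) (ℕP.+-identityʳ H)) (ℕP.m+n∸n≡m H H))

  p∸1≢1 : p ∸ 1 ≢ 1
  p∸1≢1 p∸1≡1 = ℕP.even≢odd H 0 (trans (sym (cong (_∸ 1) p≡1+2H)) p∸1≡1)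

  p∸1<p : p ∸ 1 < p
  p∸1<p = ℕP.∸-monoʳ-< {p} {1} {0} (s≤s z≤n) (ℕP.<⇒≤ 1<p)

  [p∸1+1]%p≡0 : (p ∸ 1 + 1) % p ≡ 0
  [p∸1+1]%p≡0 = trans (cong (_% p) (ℕP.m∸n+n≡m (ℕP.<⇒≤ 1<p))) (n%n≡0 p)

  neg-of-1 : ∀ {u v} → (u + v) % p ≡ 0 → v % p ≡ 1 → u % p ≡ p ∸ 1
  neg-of-1 {u} {v} u+v≡0 v≡1 = trans (+≡0-unique v p u+v≡0 p∸1+v≡0) (m<n⇒m%n≡m p∸1<p)
    where
    p∸1+v≡0 : (p ∸ 1 + v) % p ≡ 0
    p∸1+v≡0 = trans (+-cong-mod p refl (trans v≡1 (sym (m<n⇒m%n≡m 1<p)))) [p∸1+1]%p≡0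

  ±reciprocal : ℕ → ℕ → Bool
  ±reciprocal x y = ((x * y) % p ≡ᵇ 1) ∨ ((x * y) % p ≡ᵇ p ∸ 1)

  ±reciprocal-comm : ∀ x y → ±reciprocal x y ≡ ±reciprocal y x
  ±reciprocal-comm x y = cong (λ w → (w % p ≡ᵇ 1) ∨ (w % p ≡ᵇ p ∸ 1)) (ℕP.*-comm x y)

  ±reciprocal⇒ : ∀ x y → ±reciprocal x y ≡ true → (x * y) % p ≡ 1 ⊎ (x * y) % p ≡ p ∸ 1
  ±reciprocal⇒ x y r with (x * y) % p ≡ᵇ 1 in xy≡1
  ... | true = inj₁ (≡ᵇ⇒≡ xy≡1)
  ... | false = inj₂ (≡ᵇ⇒≡ r)

  reciprocal⇒±reciprocal : ∀ x y → (x * y) % p ≡ 1 → ±reciprocal x y ≡ true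
  reciprocal⇒±reciprocal x y xy≡1 rewrite xy≡1 = refl

  neg-reciprocal⇒±reciprocal : ∀ x y → (x * y) % p ≡ p ∸ 1 → ±reciprocal x y ≡ true
  neg-reciprocal⇒±reciprocal x y xy≡-1 rewrite xy≡-1 | ≡ᵇ-refl (p ∸ 1) = ∨-zeroʳ _

  reciprocal-signs-clash : ∀ {x y y′} → p ∤ x → 0 < y → y + y′ < p →
                           (x * y) % p ≡ 1 → (x * y′) % p ≡ p ∸ 1 → ⊥
  reciprocal-signs-clash {x} {y} {y′} p∤x 0<y y+y′<p xy≡1 xy′≡-1
    with euclidsLemma x (y + y′) p-prime (m%n≡0⇒n∣m _ p x[y+y′]≡0)
    where
    x[y+y′]≡0 : (x * (y + y′)) % p ≡ 0
    x[y+y′]≡0 = begin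
      (x * (y + y′)) % p        ≡⟨ cong (_% p) (ℕP.*-distribˡ-+ x y y′) ⟩
      (x * y + x * y′) % p      ≡⟨ +-cong-mod p (trans xy≡1 (sym (m<n⇒m%n≡m 1<p))) refl ⟩
      (1 + x * y′) % p          ≡⟨ +-cong-mod p refl (trans xy′≡-1 (sym (m<n⇒m%n≡m p∸1<p))) ⟩
      (1 + (p ∸ 1)) % p         ≡⟨ cong (_% p) (ℕP.+-comm 1 (p ∸ 1)) ⟩
      (p ∸ 1 + 1) % p           ≡⟨ [p∸1+1]%p≡0 ⟩
      0                         ∎
  ... | inj₁ p∣x = p∤x p∣x
  ... | inj₂ p∣y+y′ = ℕP.<-irrefl (sym (∣∧<⇒≡0 p∣y+y′ y+y′<p)) (ℕP.≤-trans 0<y (ℕP.m≤m+n y y′))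

  inverse : ∀ {x} → p ∤ x → ∃ λ y → 0 < y × y < p × (x * y) % p ≡ 1
  inverse {x} p∤x with count>0⇒∃ p _ (ℕP.≤-reflexive (sym (*-complete x p∤x 1 1<p)))
  ... | y , y<p , xy≡1 = y , ℕP.n≢0⇒n>0 y≢0 , y<p , ≡ᵇ⇒≡ xy≡1
    where
    y≢0 : y ≢ 0
    y≢0 refl = case trans (sym (m<n⇒m%n≡m 0<p)) (trans (cong (_% p) (sym (ℕP.*-zeroʳ x))) (≡ᵇ⇒≡ xy≡1)) of λ ()

  partner-exists : ∀ {x} → 0 < x → x ≤ H → ∃ λ y → 0 < y × y ≤ H × ±reciprocal x y ≡ true
  partner-exists {x} 0<x x≤H = choose (inverse (∤-between 0<x (≤H⇒<p x≤H)))
    where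
    choose : (∃ λ y → 0 < y × y < p × (x * y) % p ≡ 1) → ∃ λ y → 0 < y × y ≤ H × ±reciprocal x y ≡ true
    choose (y , 0<y , y<p , xy≡1) with y ℕP.≤? H
    ... | yes y≤H = y , 0<y , y≤H , reciprocal⇒±reciprocal x y xy≡1
    ... | no y≰H = p ∸ y , ℕP.m<n⇒0<n∸m y<p , p∸y≤H ,
                   neg-reciprocal⇒±reciprocal x (p ∸ y) (neg-of-1 x[p∸y]+xy≡0 xy≡1)
      where
      p∸y≤H : p ∸ y ≤ H
      p∸y≤H = ℕP.≤-trans (ℕP.∸-monoʳ-≤ p (ℕP.≰⇒> y≰H)) (ℕP.≤-reflexive p∸[1+H]≡H)
      x[p∸y]+xy≡0 : (x * (p ∸ y) + x * y) % p ≡ 0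
      x[p∸y]+xy≡0 = begin
        (x * (p ∸ y) + x * y) % p  ≡⟨ cong (_% p) (ℕP.*-distribˡ-+ x (p ∸ y) y) ⟨
        (x * (p ∸ y + y)) % p      ≡⟨ cong (λ w → (x * w) % p) (ℕP.m∸n+n≡m (ℕP.<⇒≤ y<p)) ⟩
        (x * p) % p                ≡⟨ m*n%n≡0 x p ⟩
        0                          ∎

  ≤H+≤H⇒<p : ∀ {y y′} → y ≤ H → y′ ≤ H → y + y′ < p
  ≤H+≤H⇒<p y≤H y′≤H = ℕP.≤-trans (s≤s (ℕP.≤-trans (ℕP.+-mono-≤ y≤H y′≤H) (ℕP.≤-reflexive (cong (λ t → H + t) (sym (ℕP.+-identityʳ H))))))
                                   (ℕP.≤-reflexive (sym p≡1+2H))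

  partner-unique : ∀ {x} → p ∤ x → AtMostOne H (λ j → ±reciprocal x (suc j))
  partner-unique {x} p∤x j j′ j<H j′<H r r′ with ±reciprocal⇒ x (suc j) r | ±reciprocal⇒ x (suc j′) r′
  ... | inj₁ xy≡1 | inj₁ xy′≡1 = ℕP.suc-injective (*-cancelˡ-mod x p∤x (≤H⇒<p j<H) (≤H⇒<p j′<H) (trans xy≡1 (sym xy′≡1)))
  ... | inj₂ xy≡-1 | inj₂ xy′≡-1 = ℕP.suc-injective (*-cancelˡ-mod x p∤x (≤H⇒<p j<H) (≤H⇒<p j′<H) (trans xy≡-1 (sym xy′≡-1)))
  ... | inj₁ xy≡1 | inj₂ xy′≡-1 = ⊥-elim (reciprocal-signs-clash p∤x (s≤s z≤n) (≤H+≤H⇒<p j<H j′<H) xy≡1 xy′≡-1)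
  ... | inj₂ xy≡-1 | inj₁ xy′≡1 = ⊥-elim (reciprocal-signs-clash p∤x (s≤s z≤n) (≤H+≤H⇒<p j′<H j<H) xy′≡1 xy≡-1)

  partner : ℕ → ℕ → ℕ
  partner i j = 𝟙 (±reciprocal (suc i) (suc j))

  partners : ∀ i → i < H → Σℕ H (partner i) ≡ 1
  partners i i<H with partner-exists (s≤s z≤n) i<H
  ... | suc j , _ , j<H , r = count≡1 H _ (partner-unique (∤-between (s≤s z≤n) (≤H⇒<p i<H))) j j<H r

  x²≢1 : ∀ {x} → 1 < x → x ≤ H → ((x * x) % p ≡ᵇ 1) ≡ false
  x²≢1 {x} 1<x x≤H = ≢⇒≡ᵇ-false λ x²≡1 →
    case square-roots (≤H⇒<p x≤H) 1<p (trans x²≡1 (sym (m<n⇒m%n≡m 1<p))) of λ where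
      (inj₁ refl) → ℕP.<-irrefl refl 1<x
      (inj₂ x+1≡p) → ℕP.<-irrefl refl (ℕP.<-≤-trans (ℕP.m<m+n H (ℕP.<-≤-trans 0<H (ℕP.m≤m+n H 0)))
                                                     (subst (_≤ H) (x≡2H x+1≡p) x≤H))
    where
    x≡2H : x + 1 ≡ p → x ≡ 2 * H
    x≡2H x+1≡p = ℕP.suc-injective (trans (ℕP.+-comm 1 x) (trans x+1≡p p≡1+2H))

  diagonal : ∀ i → i < H → partner i i ≡ 𝟙 (i ≡ᵇ 0) + 𝟙 ((suc i * suc i) % p ≡ᵇ p ∸ 1)
  diagonal zero _ rewrite m<n⇒m%n≡m 1<p | ≢⇒≡ᵇ-false (p∸1≢1 ∘ sym) = refl
  diagonal (suc i) i<H rewrite x²≢1 (s≤s (s≤s z≤n)) i<H = refl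

  #√-1 : ℕ
  #√-1 = count H (λ i → (suc i * suc i) % p ≡ᵇ p ∸ 1)

  -- Pairing each x ∈ [1, H] with its y ∈ [1, H] such that x y ≡ ±1 splits the even number H into
  -- the fixed point x = 1, the fixed points with x² ≡ -1, and twice the number of proper pairs.
  H≡1+#√-1+2L : H ≡ suc (#√-1 + 2 * Σℕ H (λ i → Σℕ i (partner i)))
  H≡1+#√-1+2L = begin
    H                                                     ≡⟨ trans (ℕΣ.Σ-cong H partners) (Σℕ-1 H) ⟨
    Σℕ H (λ i → Σℕ H (partner i))                         ≡⟨ Σℕ²-symmetric H partner (λ i j → cong 𝟙 (±reciprocal-comm (suc i) (suc j))) ⟩
    Σℕ H (λ i → partner i i) + 2 * L                      ≡⟨ cong (_+ 2 * L) diagonal-sum ⟩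
    suc (#√-1 + 2 * L)                                    ∎
    where
    L = Σℕ H (λ i → Σℕ i (partner i))
    diagonal-sum : Σℕ H (λ i → partner i i) ≡ suc #√-1
    diagonal-sum = trans (ℕΣ.Σ-cong H diagonal) (trans (ℕΣ.Σ-distrib-⊕ H _ _) (cong (_+ #√-1) (count-≡ᵇ H 0 0<H)))

  0<#√-1 : 0 < #√-1
  0<#√-1 with #√-1 | H≡1+#√-1+2L
  ... | zero | H≡1+2L = ⊥-elim (ℕP.even≢odd (p / 4) (Σℕ H (λ i → Σℕ i (partner i))) H≡1+2L)
  ... | suc _ | _ = s≤s z≤n

  √-1 : ∃ λ i → (i * i + 1) % p ≡ 0
  √-1 with count>0⇒∃ H _ 0<#√-1
  ... | i , _ , i²≡-1 = suc i , trans (+-cong-mod p (trans (≡ᵇ⇒≡ i²≡-1) (sym (m<n⇒m%n≡m p∸1<p))) refl) [p∸1+1]%p≡0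

  square-transfer : ∀ {i a b} → (i * i + 1) % p ≡ 0 → (a + b) % p ≡ 0 → isSquareMod p a ≡ true → isSquareMod p b ≡ true
  square-transfer {i} {a} {b} i²+1≡0 a+b≡0 square with isSquareMod⇒root square
  ... | y , _ , y²≡a = root⇒isSquareMod (m%n<n (i * y) p) w²≡b
    where
    w = (i * y) % p
    factor : ∀ i y → (i * y) * (i * y) + y * y ≡ (i * i + 1) * (y * y)
    factor = solve-∀
    w²+a≡0 : (w * w + a) % p ≡ 0
    w²+a≡0 = begin
      (w * w + a) % p                   ≡⟨ +-cong-mod p (*-cong-mod p (m%n%n≡m%n (i * y) p) (m%n%n≡m%n (i * y) p)) (sym y²≡a) ⟩
      ((i * y) * (i * y) + y * y) % p   ≡⟨ cong (_% p) (factor i y) ⟩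
      ((i * i + 1) * (y * y)) % p       ≡⟨ n∣m⇒m%n≡0 _ p (∣m⇒∣m*n (y * y) (m%n≡0⇒n∣m _ p i²+1≡0)) ⟩
      0                                 ∎
    w²≡b : (w * w) % p ≡ b % p
    w²≡b = +≡0-unique a p w²+a≡0 (trans (cong (_% p) (ℕP.+-comm b a)) a+b≡0)

  zero-transfer : ∀ {a b} → (a + b) % p ≡ 0 → a % p ≡ 0 → b % p ≡ 0
  zero-transfer {a} {b} a+b≡0 a≡0 =
    trans (+≡0-unique a p (trans (cong (_% p) (ℕP.+-comm b a)) a+b≡0) a≡0) (m<n⇒m%n≡m 0<p)

  legendre-neg : ∀ {a b} → (a + b) % p ≡ 0 → legendre p a ≡ legendre p b
  legendre-neg {a} {b} a+b≡0 = begin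
    legendre p a                                ≡⟨ legendre≡χ-value a ⟩
    χ-value (a % p ≡ᵇ 0) (isSquareMod p a)      ≡⟨ cong₂ χ-value zero-iff square-iff ⟩
    χ-value (b % p ≡ᵇ 0) (isSquareMod p b)      ≡⟨ legendre≡χ-value b ⟨
    legendre p b                                ∎
    where
    b+a≡0 : (b + a) % p ≡ 0
    b+a≡0 = trans (cong (_% p) (ℕP.+-comm b a)) a+b≡0
    zero-iff : (a % p ≡ᵇ 0) ≡ (b % p ≡ᵇ 0)
    zero-iff = ≡ᵇ-cong-⇔ (zero-transfer a+b≡0) (zero-transfer b+a≡0)
    square-iff : isSquareMod p a ≡ isSquareMod p b
    square-iff = ⇔→≡ {z = true} (mk⇔ (square-transfer {proj₁ √-1} (proj₂ √-1) a+b≡0) (square-transfer {proj₁ √-1} (proj₂ √-1) b+a≡0))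

Σℤ-blocks-const : ∀ m N (f : ℕ → ℤ) → (∀ j → Σℤ N (λ a → f (j * N + a)) ≡ Σℤ N f) → Σℤ (m * N) f ≡ + m ℤ.* Σℤ N f
Σℤ-blocks-const m N f same-blocks = trans (ℤΣ.Σ-blocks m N f) (trans (ℤΣ.Σ-cong m (λ j _ → same-blocks j)) (Σℤ-const m _))

Σℤ-multiples : ∀ M e .{{_ : NonZero e}} (f : ℕ → ℤ) → Σℤ (M * e) (λ a → f a ℤ.* + 𝟙 (a % e ≡ᵇ 0)) ≡ Σℤ M (λ j → f (j * e))
Σℤ-multiples M e@(suc e′) f = trans (ℤΣ.Σ-blocks M e _) (ℤΣ.Σ-cong M (λ j _ → block j))
  where
  block : ∀ j → Σℤ e (λ r → f (j * e + r) ℤ.* + 𝟙 ((j * e + r) % e ≡ᵇ 0)) ≡ f (j * e)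
  block j = begin
    Σℤ e (λ r → f (j * e + r) ℤ.* + 𝟙 ((j * e + r) % e ≡ᵇ 0))
      ≡⟨ ℤΣ.Σ-cong e (λ r r<e → cong (λ t → f (j * e + r) ℤ.* + 𝟙 (t ≡ᵇ 0)) (trans (cong (_% e) (ℕP.+-comm (j * e) r))
                                                                            (trans ([m+kn]%n≡m%n r j e) (m<n⇒m%n≡m r<e)))) ⟩
    Σℤ e (λ r → f (j * e + r) ℤ.* + 𝟙 (r ≡ᵇ 0))
      ≡⟨ ℤΣ.Σ-sucˡ e′ (λ r → f (j * e + r) ℤ.* + 𝟙 (r ≡ᵇ 0)) ⟩
    f (j * e + 0) ℤ.* + 1 ℤ.+ Σℤ e′ (λ r → f (j * e + suc r) ℤ.* + 0)
      ≡⟨ cong₂ ℤ._+_ (ℤP.*-identityʳ (f (j * e + 0)))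
                     (trans (ℤΣ.Σ-cong e′ (λ r _ → ℤP.*-zeroʳ (f (j * e + suc r)))) (ℤΣ.Σ-0# e′)) ⟩
    f (j * e + 0) ℤ.+ + 0
      ≡⟨ trans (ℤP.+-identityʳ (f (j * e + 0))) (cong f (ℕP.+-identityʳ (j * e))) ⟩
    f (j * e) ∎

Σℤ-reflect : ∀ N (f : ℕ → ℤ) → f 0 ≡ f N → Σℤ N f ≡ Σℤ N (λ a → f (N ∸ a))
Σℤ-reflect N f f0≡fN = ∙-cancelʳ (f N) _ _ (begin
  Σℤ N f ℤ.+ f N                           ≡⟨ ℤΣ.Σ-reverse (suc N) f ⟩
  Σℤ N (λ a → f (N ∸ a)) ℤ.+ f (N ∸ N)     ≡⟨ cong (λ a → Σℤ N (λ a → f (N ∸ a)) ℤ.+ f a) (ℕP.n∸n≡0 N) ⟩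
  Σℤ N (λ a → f (N ∸ a)) ℤ.+ f 0           ≡⟨ cong (λ x → Σℤ N (λ a → f (N ∸ a)) ℤ.+ x) f0≡fN ⟩
  Σℤ N (λ a → f (N ∸ a)) ℤ.+ f N           ∎)

x+x≡0⇒x≡0 : ∀ x → x ℤ.+ x ≡ + 0 → x ≡ + 0
x+x≡0⇒x≡0 (+ zero) _ = refl

Σℤ≡0-by-reflection : ∀ N (f g : ℕ → ℤ) → f 0 ≡ f N → (∀ a → a < N → f (N ∸ a) ℤ.+ f a ≡ g a) →
                     Σℤ N g ≡ + 0 → Σℤ N f ≡ + 0
Σℤ≡0-by-reflection N f g f0≡fN pairs Σg≡0 = x+x≡0⇒x≡0 _ (begin
  Σℤ N f ℤ.+ Σℤ N f                   ≡⟨ cong (ℤ._+ Σℤ N f) (Σℤ-reflect N f f0≡fN) ⟩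
  Σℤ N (λ a → f (N ∸ a)) ℤ.+ Σℤ N f   ≡⟨ ℤΣ.Σ-distrib-⊕ N _ _ ⟨
  Σℤ N (λ a → f (N ∸ a) ℤ.+ f a)      ≡⟨ ℤΣ.Σ-cong N pairs ⟩
  Σℤ N g                              ≡⟨ Σg≡0 ⟩
  + 0                                 ∎)

[m*n+o]/n≡m+o/n : ∀ m n o .{{_ : NonZero n}} → (m * n + o) / n ≡ m + o / n
[m*n+o]/n≡m+o/n m n o = trans (+-distrib-/-∣ˡ o (n∣m*n m)) (cong (_+ o / n) (m*n/n≡m m n))

⌊h[jCk+a]/k⌋ : ∀ h j C k a .{{_ : NonZero k}} → + ((h * (j * (C * k) + a)) / k) ≡ + j ℤ.* + (h * C) ℤ.+ + ((h * a) / k)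
⌊h[jCk+a]/k⌋ h j C k a = begin
  + ((h * (j * (C * k) + a)) / k)      ≡⟨ cong (λ x → + (x / k)) (regroup h j C k a) ⟩
  + ((j * (h * C) * k + h * a) / k)    ≡⟨ cong +_ ([m*n+o]/n≡m+o/n (j * (h * C)) k (h * a)) ⟩
  + (j * (h * C) + (h * a) / k)        ≡⟨ ℤP.pos-+ (j * (h * C)) _ ⟩
  + (j * (h * C)) ℤ.+ + ((h * a) / k)  ≡⟨ cong (ℤ._+ + ((h * a) / k)) (ℤP.pos-* j (h * C)) ⟩
  + j ℤ.* + (h * C) ℤ.+ + ((h * a) / k) ∎
  where
  regroup : ∀ h j C k a → h * (j * (C * k) + a) ≡ j * (h * C) * k + h * a
  regroup = solve-∀

/-complement : ∀ x C k .{{_ : NonZero k}} → x ≤ C * k → (C * k ∸ x) / k + x / k + 1 ≡ C + 𝟙 (x % k ≡ᵇ 0)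
/-complement x C k x≤Ck with x % k in x%k≡r
... | zero = begin
  (C * k ∸ x) / k + q + 1          ≡⟨ cong (λ y → (C * k ∸ y) / k + q + 1) x≡r+qk ⟩
  (C * k ∸ q * k) / k + q + 1      ≡⟨ cong (λ y → y / k + q + 1) (ℕP.*-distribʳ-∸ k C q) ⟨
  ((C ∸ q) * k) / k + q + 1        ≡⟨ cong (λ y → y + q + 1) (m*n/n≡m (C ∸ q) k) ⟩
  C ∸ q + q + 1                    ≡⟨ cong (_+ 1) (ℕP.m∸n+n≡m q≤C) ⟩
  C + 1                            ∎
  where
  q = x / k
  x≡r+qk : x ≡ 0 + q * k
  x≡r+qk = trans (m≡m%n+[m/n]*n x k) (cong (_+ q * k) x%k≡r)
  q≤C : q ≤ C
  q≤C = ℕP.*-cancelʳ-≤ q C k (subst (_≤ C * k) x≡r+qk x≤Ck)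
... | suc r′ = begin
  (C * k ∸ x) / k + q + 1                    ≡⟨ cong (λ y → y / k + q + 1) Ck∸x≡sk+[k∸r] ⟩
  (s * k + (k ∸ r)) / k + q + 1              ≡⟨ cong (λ y → y + q + 1) (trans ([m*n+o]/n≡m+o/n s k (k ∸ r))
                                                  (cong (λ y → s + y) (m<n⇒m/n≡0 k∸r<k))) ⟩
  s + 0 + q + 1                              ≡⟨ regroup s q ⟩
  suc q + s                                  ≡⟨ ℕP.m+[n∸m]≡n q<C ⟩
  C                                          ≡⟨ ℕP.+-identityʳ C ⟨
  C + 0                                      ∎
  where
  r = suc r′
  q = x / k
  s = C ∸ suc q
  x≡r+qk : x ≡ r + q * k
  x≡r+qk = trans (m≡m%n+[m/n]*n x k) (cong (_+ q * k) x%k≡r)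
  r<k : r < k
  r<k = subst (_< k) x%k≡r (m%n<n x k)
  k∸r<k : k ∸ r < k
  k∸r<k = ℕP.∸-monoʳ-< {k} {r} {0} (s≤s z≤n) (ℕP.<⇒≤ r<k)
  q<C : q < C
  q<C = ℕP.*-cancelʳ-< k q C (ℕP.<-≤-trans (ℕP.<-≤-trans (ℕP.m<n+m (q * k) {r} (s≤s z≤n)) (ℕP.≤-reflexive (sym x≡r+qk))) x≤Ck)
  regroup : ∀ s q → s + 0 + q + 1 ≡ suc q + s
  regroup = solve-∀
  Ck∸x≡sk+[k∸r] : C * k ∸ x ≡ s * k + (k ∸ r)
  Ck∸x≡sk+[k∸r] = begin
    C * k ∸ x                                    ≡⟨ cong₂ (λ c y → c * k ∸ y) (sym (ℕP.m+[n∸m]≡n q<C)) x≡r+qk ⟩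
    (suc q + s) * k ∸ (r + q * k)                ≡⟨ cong₂ _∸_ (expand q s k) (ℕP.+-comm r (q * k)) ⟩
    (q * k + (s * k + k)) ∸ (q * k + r)          ≡⟨ ℕP.[m+n]∸[m+o]≡n∸o (q * k) _ r ⟩
    (s * k + k) ∸ r                              ≡⟨ ℕP.+-∸-assoc (s * k) (ℕP.<⇒≤ r<k) ⟩
    s * k + (k ∸ r)                              ∎
    where
    expand : ∀ q s k → (suc q + s) * k ≡ q * k + (s * k + k)
    expand = solve-∀

module Reduced (h k : ℕ) .{{_ : NonZero k}} where

  instance
    gcd≢0 : NonZero (gcd h k)
    gcd≢0 = ℕ.≢-nonZero (gcd[m,n]≢0 h k (inj₂ (ℕ.≢-nonZero⁻¹ k)))

  k′ : ℕ
  k′ = k / gcd h k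

  instance
    k′≢0 : NonZero k′
    k′≢0 = ℕ.≢-nonZero (n/gcd[m,n]≢0 h k)

  k′*gcd≡k : k′ * gcd h k ≡ k
  k′*gcd≡k = m/n*n≡m (gcd[m,n]∣n h k)

  k′∣k : k′ ∣ k
  k′∣k = divides (gcd h k) (trans (sym k′*gcd≡k) (ℕP.*-comm k′ (gcd h k)))

  k∣h*a⇔k′∣a : ∀ a → ((h * a) % k ≡ᵇ 0) ≡ (a % k′ ≡ᵇ 0)
  k∣h*a⇔k′∣a a = ≡ᵇ-cong-⇔ to from
    where
    g = gcd h k
    h′ = h / g
    h′*g≡h : h′ * g ≡ h
    h′*g≡h = m/n*n≡m (gcd[m,n]∣m h k)
    to : (h * a) % k ≡ 0 → a % k′ ≡ 0
    to k∣ha = n∣m⇒m%n≡0 a k′ (coprime-divisor (Coprime.sym (coprime-/gcd h k)) (*-cancelʳ-∣ g k′g∣h′ag))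
      where
      swap : ∀ x y z → x * y * z ≡ x * z * y
      swap = solve-∀
      k′g∣h′ag : k′ * g ∣ h′ * a * g
      k′g∣h′ag = subst₂ _∣_ (sym k′*gcd≡k) (trans (cong (_* a) (sym h′*g≡h)) (swap h′ g a)) (m%n≡0⇒n∣m _ k k∣ha)
    from : a % k′ ≡ 0 → (h * a) % k ≡ 0
    from k′∣a with m%n≡0⇒n∣m a k′ k′∣a
    ... | divides c refl = trans (cong (_% k) ha≡h′c*k) (m*n%n≡0 (h′ * c) k)
      where
      regroup : ∀ x y z w → x * y * (z * w) ≡ x * z * (w * y)
      regroup = solve-∀
      ha≡h′c*k : h * (c * k′) ≡ h′ * c * k
      ha≡h′c*k = trans (cong (_* (c * k′)) (sym h′*g≡h)) (trans (regroup h′ g c k′) (cong (h′ * c *_) k′*gcd≡k))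

module CharacterSums (p : ℕ) (p-prime : Prime p) (p≡1[4] : p % 4 ≡ 1) where

  open Legendre p p-prime p≡1[4] public

  legendre-periodic : ∀ {N} → p ∣ N → ∀ j a → legendre p (j * N + a) ≡ legendre p a
  legendre-periodic p∣N j a = legendre-mod (%-remove-+ˡ a (∣-trans p∣N (n∣m*n j)))

  legendre-reflect : ∀ {N a} → p ∣ N → a ≤ N → legendre p (N ∸ a) ≡ legendre p a
  legendre-reflect {N} p∣N a≤N = legendre-neg (trans (cong (_% p) (ℕP.m∸n+n≡m a≤N)) (n∣m⇒m%n≡0 N p p∣N))

  Σχ≡0 : ∀ {N} → p ∣ N → Σℤ N (legendre p) ≡ + 0
  Σχ≡0 (divides M refl) = begin
    Σℤ (M * p) (legendre p)             ≡⟨ Σℤ-blocks-const M p (legendre p) (λ j → ℤΣ.Σ-cong p (λ a _ → legendre-periodic ∣-refl j a)) ⟩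
    + M ℤ.* Σℤ p (legendre p)           ≡⟨ cong (+ M ℤ.*_) Σ-legendre ⟩
    + M ℤ.* + 0              ≡⟨ ℤP.*-zeroʳ (+ M) ⟩
    + 0                      ∎

  Σaχ≡0 : ∀ {N} → p ∣ N → Σℤ N (λ a → + a ℤ.* legendre p a) ≡ + 0
  Σaχ≡0 {N} p∣N = Σℤ≡0-by-reflection N (λ a → + a ℤ.* legendre p a) (λ a → + N ℤ.* legendre p a) ends pairs
                    (trans (ℤΣ.Σ-scaleˡ N (+ N) (legendre p)) (trans (cong (+ N ℤ.*_) (Σχ≡0 p∣N)) (ℤP.*-zeroʳ (+ N))))
    where
    ends : + 0 ℤ.* legendre p 0 ≡ + N ℤ.* legendre p N
    ends = trans (ℤP.*-zeroˡ (legendre p 0)) (sym (trans (cong (+ N ℤ.*_) (legendre-∣ p∣N)) (ℤP.*-zeroʳ (+ N))))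
    pairs : ∀ a → a < N → + (N ∸ a) ℤ.* legendre p (N ∸ a) ℤ.+ + a ℤ.* legendre p a ≡ + N ℤ.* legendre p a
    pairs a a<N = begin
      + (N ∸ a) ℤ.* legendre p (N ∸ a) ℤ.+ + a ℤ.* legendre p a  ≡⟨ cong (λ c → + (N ∸ a) ℤ.* c ℤ.+ + a ℤ.* legendre p a) (legendre-reflect p∣N (ℕP.<⇒≤ a<N)) ⟩
      + (N ∸ a) ℤ.* legendre p a ℤ.+ + a ℤ.* legendre p a        ≡⟨ ℤP.*-distribʳ-+ (legendre p a) (+ (N ∸ a)) (+ a) ⟨
      (+ (N ∸ a) ℤ.+ + a) ℤ.* legendre p a              ≡⟨ cong (λ n → n ℤ.* legendre p a) (trans (sym (ℤP.pos-+ (N ∸ a) a)) (cong +_ (ℕP.m∸n+n≡m (ℕP.<⇒≤ a<N)))) ⟩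
      + N ℤ.* legendre p a                              ∎

  Σχ-multiples : ∀ M e → p ∣ M * e → Σℤ M (λ j → legendre p (j * e)) ≡ + 0
  Σχ-multiples M e p∣Me with p ∣? e | euclidsLemma M e p-prime p∣Me
  ... | yes p∣e | _ = trans (ℤΣ.Σ-cong M (λ j _ → legendre-∣ (∣-trans p∣e (n∣m*n j)))) (ℤΣ.Σ-0# M)
  ... | no p∤e | inj₂ p∣e = ⊥-elim (p∤e p∣e)
  ... | no p∤e | inj₁ (divides M′ refl) = begin
    Σℤ (M′ * p) (λ j → legendre p (j * e))       ≡⟨ Σℤ-blocks-const M′ p _ (λ j → ℤΣ.Σ-cong p (λ b _ → periodic j b)) ⟩
    + M′ ℤ.* Σℤ p (λ j → legendre p (j * e))     ≡⟨ cong (+ M′ ℤ.*_) (trans (ℤΣ.Σ-cong p (λ b _ → cong (legendre p) (ℕP.*-comm b e))) (Σ-legendre-* e p∤e)) ⟩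
    + M′ ℤ.* + 0                        ≡⟨ ℤP.*-zeroʳ (+ M′) ⟩
    + 0                                 ∎
    where
    periodic : ∀ j b → legendre p ((j * p + b) * e) ≡ legendre p (b * e)
    periodic j b = trans (cong (legendre p) (expand j p b e)) (legendre-periodic ∣-refl (j * e) (b * e))
      where
      expand : ∀ j p b e → (j * p + b) * e ≡ j * e * p + b * e
      expand = solve-∀

  Σχ[k∣ha]≡0 : ∀ h k {N} .{{_ : NonZero k}} → p ∣ N → k ∣ N → Σℤ N (λ a → legendre p a ℤ.* + 𝟙 ((h * a) % k ≡ᵇ 0)) ≡ + 0
  Σχ[k∣ha]≡0 h k p∣N k∣N with ∣-trans (Reduced.k′∣k h k) k∣N
  ... | divides M refl = begin
    Σℤ (M * k′) (λ a → legendre p a ℤ.* + 𝟙 ((h * a) % k ≡ᵇ 0))   ≡⟨ ℤΣ.Σ-cong (M * k′) (λ a _ → cong (λ b → legendre p a ℤ.* + 𝟙 b) (k∣h*a⇔k′∣a a)) ⟩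
    Σℤ (M * k′) (λ a → legendre p a ℤ.* + 𝟙 (a % k′ ≡ᵇ 0))        ≡⟨ Σℤ-multiples M k′ (legendre p) ⟩
    Σℤ M (λ j → legendre p (j * k′))                              ≡⟨ Σχ-multiples M k′ p∣N ⟩
    + 0                                                  ∎
    where open Reduced h k

  Σχ⌊ha/k⌋≡0 : ∀ h k C .{{_ : NonZero k}} → p ∣ C * k → Σℤ (C * k) (λ a → legendre p a ℤ.* + ((h * a) / k)) ≡ + 0
  Σχ⌊ha/k⌋≡0 h k C p∣N = Σℤ≡0-by-reflection N f g ends pairs Σg≡0
    where
    N = C * k
    hC = + (h * C)
    f g : ℕ → ℤ
    f a = legendre p a ℤ.* + ((h * a) / k)
    g a = (hC ℤ.- + 1) ℤ.* legendre p a ℤ.+ legendre p a ℤ.* + 𝟙 ((h * a) % k ≡ᵇ 0)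
    ends : f 0 ≡ f N
    ends = trans (cong (ℤ._* + ((h * 0) / k)) (legendre-∣ (divides 0 refl)))
                 (sym (cong (ℤ._* + ((h * N) / k)) (legendre-∣ p∣N)))
    Σg≡0 : Σℤ N g ≡ + 0
    Σg≡0 = begin
      Σℤ N g                                                         ≡⟨ ℤΣ.Σ-distrib-⊕ N _ _ ⟩
      Σℤ N (λ a → (hC ℤ.- + 1) ℤ.* legendre p a) ℤ.+ Σℤ N (λ a → legendre p a ℤ.* _)   ≡⟨ cong₂ ℤ._+_ (ℤΣ.Σ-scaleˡ N (hC ℤ.- + 1) (legendre p))
                                                                          (Σχ[k∣ha]≡0 h k p∣N (n∣m*n C)) ⟩
      (hC ℤ.- + 1) ℤ.* Σℤ N (legendre p) ℤ.+ + 0                                ≡⟨ cong (λ s → (hC ℤ.- + 1) ℤ.* s ℤ.+ + 0) (Σχ≡0 p∣N) ⟩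
      (hC ℤ.- + 1) ℤ.* + 0 ℤ.+ + 0                                   ≡⟨ cong (ℤ._+ + 0) (ℤP.*-zeroʳ (hC ℤ.- + 1)) ⟩
      + 0                                                            ∎
    floors : ∀ a → a < N → (h * (N ∸ a)) / k + (h * a) / k + 1 ≡ h * C + 𝟙 ((h * a) % k ≡ᵇ 0)
    floors a a<N = trans (cong (λ x → x / k + (h * a) / k + 1) h[N∸a]≡hCk∸ha)
                         (/-complement (h * a) (h * C) k (subst (h * a ≤_) (sym (ℕP.*-assoc h C k)) (ℕP.*-monoʳ-≤ h (ℕP.<⇒≤ a<N))))
      where
      h[N∸a]≡hCk∸ha : h * (N ∸ a) ≡ h * C * k ∸ h * a
      h[N∸a]≡hCk∸ha = trans (ℕP.*-distribˡ-∸ h N a) (cong (_∸ h * a) (sym (ℕP.*-assoc h C k)))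
    pairs : ∀ a → a < N → f (N ∸ a) ℤ.+ f a ≡ g a
    pairs a a<N = begin
      legendre p (N ∸ a) ℤ.* + A ℤ.+ legendre p a ℤ.* + B            ≡⟨ cong (λ c → c ℤ.* + A ℤ.+ legendre p a ℤ.* + B) (legendre-reflect p∣N (ℕP.<⇒≤ a<N)) ⟩
      legendre p a ℤ.* + A ℤ.+ legendre p a ℤ.* + B                  ≡⟨ factor (legendre p a) (+ A) (+ B) ⟩
      legendre p a ℤ.* (+ A ℤ.+ + B ℤ.+ + 1) ℤ.- legendre p a        ≡⟨ cong (λ s → legendre p a ℤ.* s ℤ.- legendre p a) A+B+1≡hC+I ⟩
      legendre p a ℤ.* (hC ℤ.+ + I) ℤ.- legendre p a                 ≡⟨ unfactor (legendre p a) hC (+ I) ⟩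
      g a                                          ∎
      where
      A = (h * (N ∸ a)) / k
      B = (h * a) / k
      I = 𝟙 ((h * a) % k ≡ᵇ 0)
      A+B+1≡hC+I : + A ℤ.+ + B ℤ.+ + 1 ≡ hC ℤ.+ + I
      A+B+1≡hC+I = trans (sym (trans (ℤP.pos-+ (A + B) 1) (cong (ℤ._+ + 1) (ℤP.pos-+ A B))))
                         (trans (cong +_ (floors a a<N)) (ℤP.pos-+ (h * C) I))
      factor : ∀ c x y → c ℤ.* x ℤ.+ c ℤ.* y ≡ c ℤ.* (x ℤ.+ y ℤ.+ + 1) ℤ.- c
      factor = ℤ-Solver.solve-∀
      unfactor : ∀ c x y → c ℤ.* (x ℤ.+ y) ℤ.- c ≡ (x ℤ.- + 1) ℤ.* c ℤ.+ c ℤ.* y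
      unfactor = ℤ-Solver.solve-∀

  Tχ : ℕ → ℕ → ℕ → ℤ
  Tχ h k M = Σℤ M (λ μ → + μ ℤ.* legendre p μ ℤ.* + divℕ (h * μ) k)

  Tχ-cancel : ∀ q h k M .{{_ : NonZero q}} .{{_ : NonZero k}} → Tχ (q * h) (q * k) M ≡ Tχ h k M
  Tχ-cancel q h k M = ℤΣ.Σ-cong M (λ μ _ → cong (λ n → + μ ℤ.* legendre p μ ℤ.* + n) (begin
    divℕ (q * h * μ) (q * k)      ≡⟨ divℕ≡/ (q * h * μ) (q * k) ⟩
    (q * h * μ) / (q * k)         ≡⟨ /-congˡ {o = q * k} (ℕP.*-assoc q h μ) ⟩
    (q * (h * μ)) / (q * k)       ≡⟨ m*n/m*o≡n/o q (h * μ) k ⟩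
    (h * μ) / k                   ≡⟨ divℕ≡/ (h * μ) k ⟨
    divℕ (h * μ) k                ∎))
    where
    instance
      qk≢0 : NonZero (q * k)
      qk≢0 = ℕP.m*n≢0 q k

  Tχ-periods : ∀ h k C m .{{_ : NonZero k}} → p ∣ C * k → Tχ h k (m * (C * k)) ≡ + m ℤ.* Tχ h k (C * k)
  Tχ-periods h k C m p∣N = begin
    Tχ h k (m * N)        ≡⟨ Tχ≡Σt (m * N) ⟩
    Σℤ (m * N) t          ≡⟨ Σℤ-blocks-const m N t block ⟩
    + m ℤ.* Σℤ N t        ≡⟨ cong (+ m ℤ.*_) (Tχ≡Σt N) ⟨
    + m ℤ.* Tχ h k N      ∎
    where
    N = C * k
    hC = + (h * C)
    t linear quadratic : ℕ → ℤ
    t μ = + μ ℤ.* legendre p μ ℤ.* + ((h * μ) / k)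
    linear a = + N ℤ.* (legendre p a ℤ.* + ((h * a) / k)) ℤ.+ hC ℤ.* (+ a ℤ.* legendre p a)
    quadratic a = (+ N ℤ.* hC) ℤ.* legendre p a
    Tχ≡Σt : ∀ M → Tχ h k M ≡ Σℤ M t
    Tχ≡Σt M = ℤΣ.Σ-cong M (λ μ _ → cong (λ n → + μ ℤ.* legendre p μ ℤ.* + n) (divℕ≡/ (h * μ) k))
    Σlinear≡0 : Σℤ N linear ≡ + 0
    Σlinear≡0 = begin
      Σℤ N linear                                                                   ≡⟨ ℤΣ.Σ-distrib-⊕ N _ _ ⟩
      Σℤ N (λ a → + N ℤ.* (legendre p a ℤ.* + ((h * a) / k))) ℤ.+ Σℤ N (λ a → hC ℤ.* (+ a ℤ.* legendre p a))
        ≡⟨ cong₂ ℤ._+_ (ℤΣ.Σ-scaleˡ N (+ N) _) (ℤΣ.Σ-scaleˡ N hC _) ⟩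
      + N ℤ.* Σℤ N (λ a → legendre p a ℤ.* + ((h * a) / k)) ℤ.+ hC ℤ.* Σℤ N (λ a → + a ℤ.* legendre p a)
        ≡⟨ cong₂ (λ x y → + N ℤ.* x ℤ.+ hC ℤ.* y) (Σχ⌊ha/k⌋≡0 h k C p∣N) (Σaχ≡0 p∣N) ⟩
      + N ℤ.* + 0 ℤ.+ hC ℤ.* + 0                                                    ≡⟨ cong₂ ℤ._+_ (ℤP.*-zeroʳ (+ N)) (ℤP.*-zeroʳ hC) ⟩
      + 0                                                                           ∎
    Σquadratic≡0 : Σℤ N quadratic ≡ + 0
    Σquadratic≡0 = trans (ℤΣ.Σ-scaleˡ N (+ N ℤ.* hC) (legendre p)) (trans (cong (+ N ℤ.* hC ℤ.*_) (Σχ≡0 p∣N)) (ℤP.*-zeroʳ (+ N ℤ.* hC)))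
    expand : ∀ j a → t (j * N + a) ≡ t a ℤ.+ + j ℤ.* linear a ℤ.+ (+ j ℤ.* + j) ℤ.* quadratic a
    expand j a = begin
      + (j * N + a) ℤ.* legendre p (j * N + a) ℤ.* + ((h * (j * N + a)) / k)
        ≡⟨ cong₂ (λ x y → x ℤ.* y ℤ.* + ((h * (j * N + a)) / k)) (trans (ℤP.pos-+ (j * N) a) (cong (ℤ._+ + a) (ℤP.pos-* j N)))
                                                                  (legendre-periodic p∣N j a) ⟩
      (+ j ℤ.* + N ℤ.+ + a) ℤ.* legendre p a ℤ.* + ((h * (j * N + a)) / k)
        ≡⟨ cong (λ x → (+ j ℤ.* + N ℤ.+ + a) ℤ.* legendre p a ℤ.* x) (⌊h[jCk+a]/k⌋ h j C k a) ⟩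
      (+ j ℤ.* + N ℤ.+ + a) ℤ.* legendre p a ℤ.* (+ j ℤ.* hC ℤ.+ + ((h * a) / k))
        ≡⟨ polynomial (+ j) (+ N) (+ a) (legendre p a) (+ ((h * a) / k)) hC ⟩
      t a ℤ.+ + j ℤ.* linear a ℤ.+ (+ j ℤ.* + j) ℤ.* quadratic a ∎
      where
      polynomial : ∀ j N a c F hC → (j ℤ.* N ℤ.+ a) ℤ.* c ℤ.* (j ℤ.* hC ℤ.+ F) ≡
        a ℤ.* c ℤ.* F ℤ.+ j ℤ.* (N ℤ.* (c ℤ.* F) ℤ.+ hC ℤ.* (a ℤ.* c)) ℤ.+ (j ℤ.* j) ℤ.* ((N ℤ.* hC) ℤ.* c)
      polynomial = ℤ-Solver.solve-∀
    block : ∀ j → Σℤ N (λ a → t (j * N + a)) ≡ Σℤ N t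
    block j = begin
      Σℤ N (λ a → t (j * N + a))                                                    ≡⟨ ℤΣ.Σ-cong N (λ a _ → expand j a) ⟩
      Σℤ N (λ a → t a ℤ.+ + j ℤ.* linear a ℤ.+ (+ j ℤ.* + j) ℤ.* quadratic a)         ≡⟨ ℤΣ.Σ-distrib-⊕ N _ _ ⟩
      Σℤ N (λ a → t a ℤ.+ + j ℤ.* linear a) ℤ.+ Σℤ N (λ a → (+ j ℤ.* + j) ℤ.* quadratic a)
        ≡⟨ cong₂ ℤ._+_ (trans (ℤΣ.Σ-distrib-⊕ N _ _) (cong (λ x → Σℤ N t ℤ.+ x) (ℤΣ.Σ-scaleˡ N (+ j) linear)))
                       (ℤΣ.Σ-scaleˡ N (+ j ℤ.* + j) quadratic) ⟩
      Σℤ N t ℤ.+ + j ℤ.* Σℤ N linear ℤ.+ (+ j ℤ.* + j) ℤ.* Σℤ N quadratic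
        ≡⟨ cong₂ (λ x y → Σℤ N t ℤ.+ + j ℤ.* x ℤ.+ (+ j ℤ.* + j) ℤ.* y) Σlinear≡0 Σquadratic≡0 ⟩
      Σℤ N t ℤ.+ + j ℤ.* + 0 ℤ.+ (+ j ℤ.* + j) ℤ.* + 0                               ≡⟨ drop-zeros (Σℤ N t) (+ j) ⟩
      Σℤ N t                                                                        ∎
      where
      drop-zeros : ∀ s j → s ℤ.+ j ℤ.* + 0 ℤ.+ (j ℤ.* j) ℤ.* + 0 ≡ s
      drop-zeros = ℤ-Solver.solve-∀

toℚᵘ-÷ℤ : ∀ z d → toℚᵘ (z ÷ℤ suc d) ≃ᵘ mkℚᵘ z d
toℚᵘ-÷ℤ z d = ℚP.toℚᵘ-fromℚᵘ (mkℚᵘ z d)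

÷ℤ-cross : ∀ z w b d .{{_ : NonZero b}} .{{_ : NonZero d}} → z ℤ.* + d ≡ w ℤ.* + b → z ÷ℤ b ≡ w ÷ℤ d
÷ℤ-cross z w (suc b) (suc d) eq = ℚP.fromℚᵘ-cong {mkℚᵘ z b} {mkℚᵘ w d} (*≡* eq)

÷ℤ-neg : ∀ z D .{{_ : NonZero D}} → ℚ.- (z ÷ℤ D) ≡ (ℤ.- z) ÷ℤ D
÷ℤ-neg z (suc d) = ℚP.toℚᵘ-injective (ℚᵘP.≃-trans (ℚP.toℚᵘ-homo‿- (z ÷ℤ suc d))
  (ℚᵘP.≃-trans (ℚᵘP.-‿cong (toℚᵘ-÷ℤ z d)) (ℚᵘP.≃-sym (toℚᵘ-÷ℤ (ℤ.- z) d))))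

÷ℤ-+ : ∀ z w D .{{_ : NonZero D}} → (z ÷ℤ D) ℚ.+ (w ÷ℤ D) ≡ (z ℤ.+ w) ÷ℤ D
÷ℤ-+ z w D@(suc d) = ℚP.toℚᵘ-injective (ℚᵘP.≃-trans (ℚP.toℚᵘ-homo-+ (z ÷ℤ D) (w ÷ℤ D))
  (ℚᵘP.≃-trans (ℚᵘP.+-cong (toℚᵘ-÷ℤ z d) (toℚᵘ-÷ℤ w d)) (ℚᵘP.≃-trans (*≡* cross) (ℚᵘP.≃-sym (toℚᵘ-÷ℤ (z ℤ.+ w) d)))))
  where
  factor : ∀ z w x → (z ℤ.* x ℤ.+ w ℤ.* x) ℤ.* x ≡ (z ℤ.+ w) ℤ.* (x ℤ.* x)
  factor = ℤ-Solver.solve-∀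
  cross : (z ℤ.* + D ℤ.+ w ℤ.* + D) ℤ.* + D ≡ (z ℤ.+ w) ℤ.* + (D * D)
  cross = trans (factor z w (+ D)) (cong ((z ℤ.+ w) ℤ.*_) (sym (ℤP.pos-* D D)))

÷ℤ-* : ∀ z w b d .{{_ : NonZero b}} .{{_ : NonZero d}} → (z ÷ℤ b) ℚ.* (w ÷ℤ d) ≡ (z ℤ.* w) ÷ℤ (b * d)
÷ℤ-* z w (suc b) (suc d) = ℚP.toℚᵘ-injective (ℚᵘP.≃-trans (ℚP.toℚᵘ-homo-* (z ÷ℤ suc b) (w ÷ℤ suc d))
  (ℚᵘP.≃-trans (ℚᵘP.*-cong (toℚᵘ-÷ℤ z b) (toℚᵘ-÷ℤ w d)) (ℚᵘP.≃-sym (toℚᵘ-÷ℤ (z ℤ.* w) _))))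

÷ℤ-- : ∀ z w D .{{_ : NonZero D}} → (z ÷ℤ D) ℚ.- (w ÷ℤ D) ≡ (z ℤ.- w) ÷ℤ D
÷ℤ-- z w D = trans (cong ((z ÷ℤ D) ℚ.+_) (÷ℤ-neg w D)) (÷ℤ-+ z (ℤ.- w) D)

Σℚ-÷ℤ : ∀ n (z : ℕ → ℤ) D .{{_ : NonZero D}} → Σℚ n (λ μ → z μ ÷ℤ D) ≡ Σℤ n z ÷ℤ D
Σℚ-÷ℤ zero z D = ÷ℤ-cross (+ 0) (+ 0) 1 D refl
Σℚ-÷ℤ (suc n) z D = trans (cong (ℚ._+ (z n ÷ℤ D)) (Σℚ-÷ℤ n z D)) (÷ℤ-+ (Σℤ n z) (z n) D)

-- The reduced form of x is (n/g)/(D/g), and scaling by g changes neither the floor nor whether D divides n.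
floor∧integral-scaled : ∀ (x : ℚ) n D g .{{_ : NonZero D}} → ↥ x ℤ.* + suc g ≡ + n → ↧ x ℤ.* + suc g ≡ + D →
                        ℚ.floor x ≡ + (n / D) × (↧ₙ x ≡ᵇ 1) ≡ (n % D ≡ᵇ 0)
floor∧integral-scaled (mkℚ (+ a) c′ coprime) n D g ↥x*g≡n ↧x*g≡D
  with ℤP.+-injective (trans (ℤP.pos-* a (suc g)) ↥x*g≡n) | ℤP.+-injective (trans (ℤP.pos-* (suc c′) (suc g)) ↧x*g≡D)
... | refl | refl = floor-scaled , ≡ᵇ-cong-⇔ c≡1⇒c∣a c∣a⇒c≡1
  where
  c = suc c′
  floor-scaled : ℚ.floor (mkℚ (+ a) c′ coprime) ≡ + ((a * suc g) / (c * suc g))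
  floor-scaled = trans (ℤP.*-identityˡ (+ (a / c))) (cong +_ (sym (m*n/o*n≡m/o a (suc g) c)))
  c≡1⇒c∣a : c ≡ 1 → (a * suc g) % (c * suc g) ≡ 0
  c≡1⇒c∣a c≡1 = trans (%-congʳ {o = a * suc g} (trans (cong (_* suc g) c≡1) (ℕP.*-identityˡ (suc g)))) (m*n%n≡0 a (suc g))
  c∣a⇒c≡1 : (a * suc g) % (c * suc g) ≡ 0 → c ≡ 1
  c∣a⇒c≡1 cg∣ag with m%n≡0⇒n∣m (a * suc g) (c * suc g) cg∣ag
  ... | divides t ag≡tcg = Coprime.recompute coprime (c∣a , ∣-refl)
    where
    c∣a = divides t (ℕP.*-cancelʳ-≡ a (t * c) (suc g) (trans ag≡tcg (sym (ℕP.*-assoc t c (suc g)))))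

floor∧integral-÷ℤ : ∀ n D .{{_ : NonZero D}} → ℚ.floor ((+ n) ÷ℤ D) ≡ + (n / D) × (↧ₙ ((+ n) ÷ℤ D) ≡ᵇ 1) ≡ (n % D ≡ᵇ 0)
floor∧integral-÷ℤ n D@(suc d) = by-gcd (gcd n D) refl
  where
  by-gcd : ∀ G → gcd n D ≡ G → ℚ.floor ((+ n) ÷ℤ D) ≡ + (n / D) × (↧ₙ ((+ n) ÷ℤ D) ≡ᵇ 1) ≡ (n % D ≡ᵇ 0)
  by-gcd zero gcd≡0 = ⊥-elim (gcd[m,n]≢0 n D (inj₂ (λ ())) gcd≡0)
  by-gcd (suc g) gcd≡1+g = floor∧integral-scaled ((+ n) ÷ℤ D) n D g
    (subst (λ G → ↥ ((+ n) ÷ℤ D) ℤ.* + G ≡ + n) gcd≡1+g (ℚP.↥-/ (+ n) D))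
    (subst (λ G → ↧ ((+ n) ÷ℤ D) ℤ.* + G ≡ + D) gcd≡1+g (ℚP.↧-/ (+ n) D))

-- saw n D = 2D · ((n / D)), an integer; the value at D = 0 is junk.
saw : ℕ → ℕ → ℤ
saw n zero = + 0
saw n D@(suc _) = if n % D ≡ᵇ 0 then + 0 else + (2 * (n % D)) ℤ.- + D

2n-2D[n/D]≡2[n%D] : ∀ n D .{{_ : NonZero D}} → + (2 * n) ℤ.- + (n / D) ℤ.* + (2 * D) ≡ + 2 ℤ.* + (n % D)
2n-2D[n/D]≡2[n%D] n D = begin
  + (2 * n) ℤ.- + q ℤ.* + (2 * D)
    ≡⟨ cong₂ (λ u v → u ℤ.- + q ℤ.* v) (trans (ℤP.pos-* 2 n) (cong (+ 2 ℤ.*_) n≡r+qD)) (ℤP.pos-* 2 D) ⟩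
  + 2 ℤ.* (+ (n % D) ℤ.+ + q ℤ.* + D) ℤ.- + q ℤ.* (+ 2 ℤ.* + D)
    ≡⟨ cancel (+ (n % D)) (+ q) (+ D) ⟩
  + 2 ℤ.* + (n % D) ∎
  where
  q = n / D
  n≡r+qD : + n ≡ + (n % D) ℤ.+ + q ℤ.* + D
  n≡r+qD = trans (cong +_ (m≡m%n+[m/n]*n n D)) (trans (ℤP.pos-+ (n % D) (q * D)) (cong (λ y → + (n % D) ℤ.+ y) (ℤP.pos-* q D)))
  cancel : ∀ r q D → + 2 ℤ.* (r ℤ.+ q ℤ.* D) ℤ.- q ℤ.* (+ 2 ℤ.* D) ≡ + 2 ℤ.* r
  cancel = ℤ-Solver.solve-∀

saw≡2r-D+[r≡0]D : ∀ n D .{{_ : NonZero D}} → saw n D ≡ + 2 ℤ.* + (n % D) ℤ.- + D ℤ.+ (if n % D ≡ᵇ 0 then + D else + 0)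
saw≡2r-D+[r≡0]D n D@(suc _) = by-remainder (n % D)
  where
  by-remainder : ∀ r → (if r ≡ᵇ 0 then + 0 else + (2 * r) ℤ.- + D) ≡ + 2 ℤ.* + r ℤ.- + D ℤ.+ (if r ≡ᵇ 0 then + D else + 0)
  by-remainder zero = sym (-D+D≡0 (+ D))
    where
    -D+D≡0 : ∀ D → + 2 ℤ.* + 0 ℤ.- D ℤ.+ D ≡ + 0
    -D+D≡0 = ℤ-Solver.solve-∀
  by-remainder (suc r) = sym (trans (ℤP.+-identityʳ _) (cong (ℤ._- + D) (sym (ℤP.pos-* 2 (suc r)))))

sawtooth-÷ℤ : ∀ n D .{{_ : NonZero D}} → sawtooth ((+ n) ÷ℤ D) ≡ saw n D ÷ℤ (2 * D)
sawtooth-÷ℤ n D@(suc d) = begin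
  x ℚ.- (ℚ.floor x ÷ℤ 1) ℚ.- ½ ℚ.+ (if ↧ₙ x ≡ᵇ 1 then ½ else 0ℚ)
    ≡⟨ cong₂ (λ u b → x ℚ.- (u ÷ℤ 1) ℚ.- ½ ℚ.+ (if b then ½ else 0ℚ)) (proj₁ (floor∧integral-÷ℤ n D))
                                                                   (proj₂ (floor∧integral-÷ℤ n D)) ⟩
  x ℚ.- ((+ q) ÷ℤ 1) ℚ.- ½ ℚ.+ (if b then ½ else 0ℚ)
    ≡⟨ cong₂ (λ u v → u ℚ.- v ℚ.- ½ ℚ.+ (if b then ½ else 0ℚ)) x≡ q≡ ⟩
  ((+ (2 * n)) ÷ℤ E) ℚ.- ((+ q ℤ.* + E) ÷ℤ E) ℚ.- ½ ℚ.+ (if b then ½ else 0ℚ)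
    ≡⟨ cong₂ (λ u v → ((+ (2 * n)) ÷ℤ E) ℚ.- ((+ q ℤ.* + E) ÷ℤ E) ℚ.- u ℚ.+ v) ½≡ indicator≡ ⟩
  ((+ (2 * n)) ÷ℤ E) ℚ.- ((+ q ℤ.* + E) ÷ℤ E) ℚ.- ((+ D) ÷ℤ E) ℚ.+ (I ÷ℤ E)
    ≡⟨ cong (λ u → u ℚ.- ((+ D) ÷ℤ E) ℚ.+ (I ÷ℤ E)) (÷ℤ-- (+ (2 * n)) (+ q ℤ.* + E) E) ⟩
  ((+ (2 * n) ℤ.- + q ℤ.* + E) ÷ℤ E) ℚ.- ((+ D) ÷ℤ E) ℚ.+ (I ÷ℤ E)
    ≡⟨ cong (ℚ._+ (I ÷ℤ E)) (÷ℤ-- (+ (2 * n) ℤ.- + q ℤ.* + E) (+ D) E) ⟩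
  ((+ (2 * n) ℤ.- + q ℤ.* + E ℤ.- + D) ÷ℤ E) ℚ.+ (I ÷ℤ E)
    ≡⟨ ÷ℤ-+ (+ (2 * n) ℤ.- + q ℤ.* + E ℤ.- + D) I E ⟩
  (+ (2 * n) ℤ.- + q ℤ.* + E ℤ.- + D ℤ.+ I) ÷ℤ E
    ≡⟨ cong (λ t → (t ℤ.- + D ℤ.+ I) ÷ℤ E) (2n-2D[n/D]≡2[n%D] n D) ⟩
  (+ 2 ℤ.* + (n % D) ℤ.- + D ℤ.+ I) ÷ℤ E
    ≡⟨ cong (_÷ℤ E) (saw≡2r-D+[r≡0]D n D) ⟨
  saw n D ÷ℤ E ∎
  where
  x = (+ n) ÷ℤ D
  E = 2 * D
  q = n / D
  b = n % D ≡ᵇ 0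
  I = if b then + D else + 0
  ½≡ : ½ ≡ (+ D) ÷ℤ E
  ½≡ = ÷ℤ-cross (+ 1) (+ D) 2 E (trans (ℤP.*-identityˡ (+ E)) (trans (cong +_ (ℕP.*-comm 2 D)) (ℤP.pos-* D 2)))
  x≡ : x ≡ (+ (2 * n)) ÷ℤ E
  x≡ = ÷ℤ-cross (+ n) (+ (2 * n)) D E (trans (sym (ℤP.pos-* n E)) (trans (cong +_ (rotate n 2 D)) (ℤP.pos-* (2 * n) D)))
    where
    rotate : ∀ n a b → n * (a * b) ≡ a * n * b
    rotate = solve-∀
  q≡ : (+ q) ÷ℤ 1 ≡ (+ q ℤ.* + E) ÷ℤ E
  q≡ = ÷ℤ-cross (+ q) (+ q ℤ.* + E) 1 E (sym (ℤP.*-identityʳ (+ q ℤ.* + E)))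
  indicator≡ : (if b then ½ else 0ℚ) ≡ I ÷ℤ E
  indicator≡ with b
  ... | true = ½≡
  ... | false = ÷ℤ-cross (+ 0) (+ 0) 1 E refl

saw-mod : ∀ {x y} D .{{_ : NonZero D}} → x % D ≡ y % D → saw x D ≡ saw y D
saw-mod D@(suc _) x≡y = cong (λ r → if r ≡ᵇ 0 then + 0 else + (2 * r) ℤ.- + D) x≡y

saw-scale : ∀ q x k .{{_ : NonZero q}} .{{_ : NonZero k}} → saw (q * x) (q * k) ≡ + q ℤ.* saw x k
saw-scale q@(suc _) x k@(suc _) = trans (cong (λ r → if r ≡ᵇ 0 then + 0 else + (2 * r) ℤ.- + (q * k)) qx%qk≡q*r) (scaled (x % k))
  where
  qx%qk≡q*r : (q * x) % (q * k) ≡ q * (x % k)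
  qx%qk≡q*r = sym (trans (ℕP.*-comm q (x % k))
                  (trans (m%n*o≡m*o%[n*o] x k q) (trans (%-congʳ {o = x * q} (ℕP.*-comm k q)) (%-congˡ {o = q * k} (ℕP.*-comm x q)))))
  scaled : ∀ r → (if q * r ≡ᵇ 0 then + 0 else + (2 * (q * r)) ℤ.- + (q * k)) ≡ + q ℤ.* (if r ≡ᵇ 0 then + 0 else + (2 * r) ℤ.- + k)
  scaled zero = trans (cong (λ w → if w ≡ᵇ 0 then + 0 else + (2 * w) ℤ.- + (q * k)) (ℕP.*-zeroʳ q)) (sym (ℤP.*-zeroʳ (+ q)))
  scaled (suc r) = begin
    + (2 * (q * suc r)) ℤ.- + (q * k)          ≡⟨ cong₂ ℤ._-_ (trans (ℤP.pos-* 2 (q * suc r)) (cong (+ 2 ℤ.*_) (ℤP.pos-* q (suc r))))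
                                                               (ℤP.pos-* q k) ⟩
    + 2 ℤ.* (+ q ℤ.* + suc r) ℤ.- + q ℤ.* + k  ≡⟨ factor (+ q) (+ suc r) (+ k) ⟩
    + q ℤ.* (+ 2 ℤ.* + suc r ℤ.- + k)          ≡⟨ cong (λ w → + q ℤ.* (w ℤ.- + k)) (ℤP.pos-* 2 (suc r)) ⟨
    + q ℤ.* (+ (2 * suc r) ℤ.- + k)            ∎
    where
    factor : ∀ q r k → + 2 ℤ.* (q ℤ.* r) ℤ.- q ℤ.* k ≡ q ℤ.* (+ 2 ℤ.* r ℤ.- k)
    factor = ℤ-Solver.solve-∀

saw-below : ∀ {x} D .{{_ : NonZero D}} → 0 < x → x < D → saw x D ≡ + (2 * x) ℤ.- + D
saw-below {suc x} D@(suc _) _ x<D rewrite m<n⇒m%n≡m x<D = refl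

saw-0 : ∀ D → saw 0 D ≡ + 0
saw-0 zero = refl
saw-0 (suc _) = refl

Σℤ-2j : ∀ n → Σℤ n (λ j → + 2 ℤ.* + j) ≡ + n ℤ.* + n ℤ.- + n
Σℤ-2j zero = refl
Σℤ-2j (suc n) = trans (cong (ℤ._+ (+ 2 ℤ.* + n)) (Σℤ-2j n)) (step (+ n))
  where
  step : ∀ x → x ℤ.* x ℤ.- x ℤ.+ + 2 ℤ.* x ≡ (+ 1 ℤ.+ x) ℤ.* (+ 1 ℤ.+ x) ℤ.- (+ 1 ℤ.+ x)
  step = ℤ-Solver.solve-∀

block<m*N : ∀ {m N j a} → j < m → a < N → j * N + a < m * N
block<m*N {m} {N} {j} {a} j<m a<N = ℕP.<-≤-trans (ℕP.+-monoʳ-< (j * N) a<N)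
                                               (ℕP.≤-trans (ℕP.≤-reflexive (ℕP.+-comm (j * N) N)) (ℕP.*-monoˡ-≤ N j<m))

-- Σ_{j<m} ((x + j/m)) = ((m x)) at x = a/(mN).
saw-distribution : ∀ m N a .{{_ : NonZero m}} .{{_ : NonZero N}} → a < N →
                   Σℤ m (λ j → saw (j * N + a) (m * N)) ≡ + m ℤ.* saw a N
saw-distribution m@(suc m′) N@(suc _) a@(suc _) a<N = begin
  Σℤ m (λ j → saw (j * N + a) (m * N))                                        ≡⟨ ℤΣ.Σ-cong m term ⟩
  Σℤ m (λ j → + N ℤ.* (+ 2 ℤ.* + j) ℤ.+ (+ 2 ℤ.* + a ℤ.- + m ℤ.* + N))          ≡⟨ ℤΣ.Σ-distrib-⊕ m _ _ ⟩
  Σℤ m (λ j → + N ℤ.* (+ 2 ℤ.* + j)) ℤ.+ Σℤ m (λ _ → + 2 ℤ.* + a ℤ.- + m ℤ.* + N)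
    ≡⟨ cong₂ ℤ._+_ (trans (ℤΣ.Σ-scaleˡ m (+ N) _) (cong (+ N ℤ.*_) (Σℤ-2j m))) (Σℤ-const m _) ⟩
  + N ℤ.* (+ m ℤ.* + m ℤ.- + m) ℤ.+ + m ℤ.* (+ 2 ℤ.* + a ℤ.- + m ℤ.* + N)       ≡⟨ collect (+ N) (+ m) (+ a) ⟩
  + m ℤ.* (+ 2 ℤ.* + a ℤ.- + N)                                                ≡⟨ cong (λ w → + m ℤ.* (w ℤ.- + N)) (ℤP.pos-* 2 a) ⟨
  + m ℤ.* (+ (2 * a) ℤ.- + N)                                                  ≡⟨ cong (+ m ℤ.*_) (saw-below N (s≤s z≤n) a<N) ⟨
  + m ℤ.* saw a N                                                              ∎
  where
  collect : ∀ N m a → N ℤ.* (m ℤ.* m ℤ.- m) ℤ.+ m ℤ.* (+ 2 ℤ.* a ℤ.- m ℤ.* N) ≡ m ℤ.* (+ 2 ℤ.* a ℤ.- N)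
  collect = ℤ-Solver.solve-∀
  expand : ∀ N j a m → + 2 ℤ.* (j ℤ.* N ℤ.+ a) ℤ.- m ℤ.* N ≡ N ℤ.* (+ 2 ℤ.* j) ℤ.+ (+ 2 ℤ.* a ℤ.- m ℤ.* N)
  expand = ℤ-Solver.solve-∀
  term : ∀ j → j < m → saw (j * N + a) (m * N) ≡ + N ℤ.* (+ 2 ℤ.* + j) ℤ.+ (+ 2 ℤ.* + a ℤ.- + m ℤ.* + N)
  term j j<m = begin
    saw (j * N + a) (m * N)                         ≡⟨ saw-below (m * N) (ℕP.<-≤-trans (s≤s z≤n) (ℕP.m≤n+m a (j * N))) (block<m*N j<m a<N) ⟩
    + (2 * (j * N + a)) ℤ.- + (m * N)               ≡⟨ cong₂ ℤ._-_ (trans (ℤP.pos-* 2 (j * N + a)) (cong (+ 2 ℤ.*_)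
                                                        (trans (ℤP.pos-+ (j * N) a) (cong (ℤ._+ + a) (ℤP.pos-* j N))))) (ℤP.pos-* m N) ⟩
    + 2 ℤ.* (+ j ℤ.* + N ℤ.+ + a) ℤ.- + m ℤ.* + N   ≡⟨ expand (+ N) (+ j) (+ a) (+ m) ⟩
    + N ℤ.* (+ 2 ℤ.* + j) ℤ.+ (+ 2 ℤ.* + a ℤ.- + m ℤ.* + N) ∎
saw-distribution m@(suc m′) N@(suc _) zero _ = begin
  Σℤ m (λ j → saw (j * N + 0) (m * N))                                   ≡⟨ ℤΣ.Σ-sucˡ m′ _ ⟩
  saw 0 (m * N) ℤ.+ Σℤ m′ (λ j → saw (suc j * N + 0) (m * N))            ≡⟨ cong₂ ℤ._+_ (saw-0 (m * N)) (ℤΣ.Σ-cong m′ term) ⟩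
  + 0 ℤ.+ Σℤ m′ (λ j → + N ℤ.* (+ 2 ℤ.* + j ℤ.+ (+ 2 ℤ.- + m)))          ≡⟨ ℤP.+-identityˡ _ ⟩
  Σℤ m′ (λ j → + N ℤ.* (+ 2 ℤ.* + j ℤ.+ (+ 2 ℤ.- + m)))                  ≡⟨ ℤΣ.Σ-scaleˡ m′ (+ N) _ ⟩
  + N ℤ.* Σℤ m′ (λ j → + 2 ℤ.* + j ℤ.+ (+ 2 ℤ.- + m))                    ≡⟨ cong (+ N ℤ.*_) (trans (ℤΣ.Σ-distrib-⊕ m′ _ _)
                                                                              (cong₂ ℤ._+_ (Σℤ-2j m′) (Σℤ-const m′ _))) ⟩
  + N ℤ.* (+ m′ ℤ.* + m′ ℤ.- + m′ ℤ.+ + m′ ℤ.* (+ 2 ℤ.- (+ 1 ℤ.+ + m′))) ≡⟨ vanish (+ N) (+ m′) ⟩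
  + m ℤ.* + 0                                                            ≡⟨ cong (+ m ℤ.*_) (saw-0 N) ⟨
  + m ℤ.* saw 0 N                                                        ∎
  where
  vanish : ∀ N m′ → N ℤ.* (m′ ℤ.* m′ ℤ.- m′ ℤ.+ m′ ℤ.* (+ 2 ℤ.- (+ 1 ℤ.+ m′))) ≡ (+ 1 ℤ.+ m′) ℤ.* + 0
  vanish = ℤ-Solver.solve-∀
  expand : ∀ N j m → + 2 ℤ.* ((+ 1 ℤ.+ j) ℤ.* N) ℤ.- m ℤ.* N ≡ N ℤ.* (+ 2 ℤ.* j ℤ.+ (+ 2 ℤ.- m))
  expand = ℤ-Solver.solve-∀
  term : ∀ j → j < m′ → saw (suc j * N + 0) (m * N) ≡ + N ℤ.* (+ 2 ℤ.* + j ℤ.+ (+ 2 ℤ.- + m))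
  term j j<m′ = begin
    saw (suc j * N + 0) (m * N)                     ≡⟨ saw-below (m * N) (ℕP.<-≤-trans (ℕP.n≢0⇒n>0 (ℕ.≢-nonZero⁻¹ N)) (ℕP.≤-trans (ℕP.m≤m+n N (j * N)) (ℕP.m≤m+n _ 0)))
                                                                          (block<m*N (s≤s j<m′) (ℕP.n≢0⇒n>0 (ℕ.≢-nonZero⁻¹ N))) ⟩
    + (2 * (suc j * N + 0)) ℤ.- + (m * N)           ≡⟨ cong₂ ℤ._-_ (trans (cong (λ w → + (2 * w)) (ℕP.+-identityʳ (suc j * N)))
                                                        (trans (ℤP.pos-* 2 (suc j * N)) (cong (+ 2 ℤ.*_) (ℤP.pos-* (suc j) N)))) (ℤP.pos-* m N) ⟩
    + 2 ℤ.* (+ suc j ℤ.* + N) ℤ.- + m ℤ.* + N       ≡⟨ expand (+ N) (+ j) (+ m) ⟩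
    + N ℤ.* (+ 2 ℤ.* + j ℤ.+ (+ 2 ℤ.- + m))         ∎

module Scaling (p : ℕ) (p-prime : Prime p) (p≡1[4] : p % 4 ≡ 1) where

  open CharacterSums p p-prime p≡1[4]

  Sχ : ℕ → ℕ → ℕ → ℤ
  Sχ h k M = Σℤ M (λ μ → legendre p μ ℤ.* saw (h * μ) k ℤ.* saw μ M)

  Σsawtooth≡Sχ : ∀ h k M .{{_ : NonZero k}} .{{_ : NonZero M}} →
                 Σℚ M (λ μ → (legendre p μ ÷ℤ 1) ℚ.* sawtooth ((+ (h * μ)) ÷ℤ k) ℚ.* sawtooth ((+ μ) ÷ℤ M))
                 ≡ Sχ h k M ÷ℤ (1 * (2 * k) * (2 * M))
  Σsawtooth≡Sχ h k@(suc _) M@(suc _) = trans (ℚΣ.Σ-cong M summand) (Σℚ-÷ℤ M (λ μ → legendre p μ ℤ.* saw (h * μ) k ℤ.* saw μ M) (1 * (2 * k) * (2 * M)))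
    where
    summand : ∀ μ → μ < M → (legendre p μ ÷ℤ 1) ℚ.* sawtooth ((+ (h * μ)) ÷ℤ k) ℚ.* sawtooth ((+ μ) ÷ℤ M)
                           ≡ (legendre p μ ℤ.* saw (h * μ) k ℤ.* saw μ M) ÷ℤ (1 * (2 * k) * (2 * M))
    summand μ _ = begin
      (legendre p μ ÷ℤ 1) ℚ.* sawtooth ((+ (h * μ)) ÷ℤ k) ℚ.* sawtooth ((+ μ) ÷ℤ M)
        ≡⟨ cong₂ (λ u v → (legendre p μ ÷ℤ 1) ℚ.* u ℚ.* v) (sawtooth-÷ℤ (h * μ) k) (sawtooth-÷ℤ μ M) ⟩
      (legendre p μ ÷ℤ 1) ℚ.* (saw (h * μ) k ÷ℤ (2 * k)) ℚ.* (saw μ M ÷ℤ (2 * M))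
        ≡⟨ cong (ℚ._* (saw μ M ÷ℤ (2 * M))) (÷ℤ-* (legendre p μ) (saw (h * μ) k) 1 (2 * k)) ⟩
      ((legendre p μ ℤ.* saw (h * μ) k) ÷ℤ (1 * (2 * k))) ℚ.* (saw μ M ÷ℤ (2 * M))
        ≡⟨ ÷ℤ-* (legendre p μ ℤ.* saw (h * μ) k) (saw μ M) (1 * (2 * k)) (2 * M) ⟩
      (legendre p μ ℤ.* saw (h * μ) k ℤ.* saw μ M) ÷ℤ (1 * (2 * k) * (2 * M)) ∎

  sχ-integral : ∀ h k M .{{_ : NonZero k}} .{{_ : NonZero M}} → φ p k * k ≡ M → sχ p h k ≡ Sχ h k M ÷ℤ (1 * (2 * k) * (2 * M))
  sχ-integral h k M refl = Σsawtooth≡Sχ h k M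

  Sχ-scale : ∀ h k C m q .{{_ : NonZero k}} .{{_ : NonZero C}} .{{_ : NonZero m}} .{{_ : NonZero q}} → p ∣ C * k →
             Sχ (q * h) (q * k) (m * (C * k)) ≡ (+ q ℤ.* + m) ℤ.* Sχ h k (C * k)
  Sχ-scale h k C m q p∣N = begin
    Σℤ (m * N) term                                                          ≡⟨ ℤΣ.Σ-blocks m N term ⟩
    Σℤ m (λ j → Σℤ N (λ a → term (j * N + a)))                               ≡⟨ ℤΣ.Σ-cong m (λ j _ → ℤΣ.Σ-cong N (λ a _ → term-block j a)) ⟩
    Σℤ m (λ j → Σℤ N (λ a → c a ℤ.* saw (j * N + a) (m * N)))                ≡⟨ ℤΣ.Σ-comm m N _ ⟩
    Σℤ N (λ a → Σℤ m (λ j → c a ℤ.* saw (j * N + a) (m * N)))                ≡⟨ ℤΣ.Σ-cong N (λ a a<N → trans (ℤΣ.Σ-scaleˡ m (c a) _)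
                                                                                  (cong (c a ℤ.*_) (saw-distribution m N a a<N))) ⟩
    Σℤ N (λ a → c a ℤ.* (+ m ℤ.* saw a N))                                   ≡⟨ ℤΣ.Σ-cong N (λ a _ → regroup (legendre p a) (+ q) (saw (h * a) k) (+ m) (saw a N)) ⟩
    Σℤ N (λ a → (+ q ℤ.* + m) ℤ.* (legendre p a ℤ.* saw (h * a) k ℤ.* saw a N))        ≡⟨ ℤΣ.Σ-scaleˡ N (+ q ℤ.* + m) _ ⟩
    (+ q ℤ.* + m) ℤ.* Sχ h k N                                               ∎
    where
    N = C * k
    instance
      N≢0 : NonZero N
      N≢0 = ℕP.m*n≢0 C k
    term c : ℕ → ℤ
    term μ = legendre p μ ℤ.* saw (q * h * μ) (q * k) ℤ.* saw μ (m * N)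
    c a = legendre p a ℤ.* (+ q ℤ.* saw (h * a) k)
    regroup : ∀ c q s m t → c ℤ.* (q ℤ.* s) ℤ.* (m ℤ.* t) ≡ (q ℤ.* m) ℤ.* (c ℤ.* s ℤ.* t)
    regroup = ℤ-Solver.solve-∀
    shift : ∀ h j C k a → h * (j * (C * k) + a) ≡ h * a + h * j * C * k
    shift = solve-∀
    term-block : ∀ j a → term (j * N + a) ≡ c a ℤ.* saw (j * N + a) (m * N)
    term-block j a = cong₂ (λ u v → u ℤ.* v ℤ.* saw (j * N + a) (m * N)) (legendre-periodic p∣N j a) (begin
      saw (q * h * (j * N + a)) (q * k)         ≡⟨ cong (λ x → saw x (q * k)) (ℕP.*-assoc q h (j * N + a)) ⟩
      saw (q * (h * (j * N + a))) (q * k)       ≡⟨ saw-scale q (h * (j * N + a)) k ⟩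
      + q ℤ.* saw (h * (j * N + a)) k           ≡⟨ cong (+ q ℤ.*_) (saw-mod k (trans (cong (_% k) (shift h j C k a))
                                                                                ([m+kn]%n≡m%n (h * a) (h * j * C) k))) ⟩
      + q ℤ.* saw (h * a) k                     ∎)

  φ-∣ : ∀ {x} → p ∣ x → φ p x ≡ 1
  φ-∣ {x} p∣x = trans (cong (divℕ p) gcd≡p) (trans (divℕ≡/ p p) (n/n≡1 p))
    where
    gcd≡p : gcd x p ≡ p
    gcd≡p = ∣-antisym (gcd[m,n]∣n x p) (gcd-greatest p∣x ∣-refl)

  φ-∤ : ∀ {x} → p ∤ x → φ p x ≡ p
  φ-∤ {x} p∤x = trans (cong (divℕ p) gcd≡1) (n/1≡n p)
    where
    gcd≡1 : gcd x p ≡ 1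
    gcd≡1 with prime⇒irreducible p-prime (gcd[m,n]∣n x p)
    ... | inj₁ gcd≡1 = gcd≡1
    ... | inj₂ gcd≡p = ⊥-elim (p∤x (subst (_∣ x) gcd≡p (gcd[m,n]∣m x p)))

  φ≢0 : ∀ k → NonZero (φ p k)
  φ≢0 k with p ∣? k
  ... | yes p∣k = subst NonZero (sym (φ-∣ p∣k)) _
  ... | no p∤k = subst NonZero (sym (φ-∤ p∤k)) p≢0

  p∣φ*k : ∀ k → p ∣ φ p k * k
  p∣φ*k k with p ∣? k
  ... | yes p∣k = subst (λ f → p ∣ f * k) (sym (φ-∣ p∣k)) (subst (p ∣_) (sym (ℕP.*-identityˡ k)) p∣k)
  ... | no p∤k = subst (λ f → p ∣ f * k) (sym (φ-∤ p∤k)) (m∣m*n k)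

  -- lcm(qk, p) = m · lcm(k, p), and correspondingly q φ(qk) = m φ(k).
  lcm-scaling : ∀ k q .{{_ : NonZero q}} →
                ∃ λ m → NonZero m × φ p (q * k) * (q * k) ≡ m * (φ p k * k) × q * φ p (q * k) ≡ m * φ p k
  lcm-scaling k q with p ∣? k | p ∣? q
  ... | yes p∣k | _ rewrite φ-∣ (∣-trans p∣k (n∣m*n q)) | φ-∣ p∣k =
    q , ℕ.≢-nonZero (ℕ.≢-nonZero⁻¹ q) , swap q k , refl
    where
    swap : ∀ q k → 1 * (q * k) ≡ q * (1 * k)
    swap = solve-∀
  ... | no p∤k | no p∤q rewrite φ-∤ (∤-* p∤q p∤k) | φ-∤ p∤k =
    q , ℕ.≢-nonZero (ℕ.≢-nonZero⁻¹ q) , swap p q k , refl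
    where
    swap : ∀ p q k → p * (q * k) ≡ q * (p * k)
    swap = solve-∀
  ... | no p∤k | yes (divides q₁ q≡q₁p) rewrite φ-∣ (∣-trans (divides q₁ q≡q₁p) (m∣m*n k)) | φ-∤ p∤k =
    q₁ , q₁≢0 , N′≡q₁N , trans (ℕP.*-identityʳ q) q≡q₁p
    where
    q₁≢0 : NonZero q₁
    q₁≢0 = ℕ.≢-nonZero (λ q₁≡0 → ℕ.≢-nonZero⁻¹ q (trans q≡q₁p (cong (_* p) q₁≡0)))
    N′≡q₁N : 1 * (q * k) ≡ q₁ * (p * k)
    N′≡q₁N = trans (ℕP.*-identityˡ (q * k)) (trans (cong (_* k) q≡q₁p) (ℕP.*-assoc q₁ p k))

  sχ-scale : ∀ h k q m .{{_ : NonZero k}} .{{_ : NonZero q}} .{{_ : NonZero m}} →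
             φ p (q * k) * (q * k) ≡ m * (φ p k * k) → sχ p (q * h) (q * k) ≡ sχ p h k
  sχ-scale h k q m N′≡mN = begin
    sχ p (q * h) (q * k)                     ≡⟨ sχ-integral (q * h) (q * k) (m * N) N′≡mN ⟩
    Sχ (q * h) (q * k) (m * N) ÷ℤ D′         ≡⟨ cong (_÷ℤ D′) (Sχ-scale h k (φ p k) m q (p∣φ*k k)) ⟩
    ((+ q ℤ.* + m) ℤ.* Sχ h k N) ÷ℤ D′       ≡⟨ ÷ℤ-cross _ _ D′ D cross ⟩
    Sχ h k N ÷ℤ D                            ≡⟨ sχ-integral h k N refl ⟨
    sχ p h k                                 ∎
    where
    N = φ p k * k
    D = 1 * (2 * k) * (2 * N)
    D′ = 1 * (2 * (q * k)) * (2 * (m * N))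
    instance
      φ≢0′ : NonZero (φ p k)
      φ≢0′ = φ≢0 k
      qk≢0 : NonZero (q * k)
      qk≢0 = ℕP.m*n≢0 q k
      N≢0 : NonZero N
      N≢0 = ℕP.m*n≢0 (φ p k) k
      mN≢0 : NonZero (m * N)
      mN≢0 = ℕP.m*n≢0 m N
      D≢0 : NonZero D
      D≢0 = ℕP.m*n≢0 (1 * (2 * k)) (2 * N) {{ℕP.m*n≢0 1 (2 * k) {{_}} {{ℕP.m*n≢0 2 k}}}} {{ℕP.m*n≢0 2 N}}
      D′≢0 : NonZero D′
      D′≢0 = ℕP.m*n≢0 (1 * (2 * (q * k))) (2 * (m * N)) {{ℕP.m*n≢0 1 (2 * (q * k)) {{_}} {{ℕP.m*n≢0 2 (q * k)}}}} {{ℕP.m*n≢0 2 (m * N)}}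
    D′≡qmD : D′ ≡ q * m * D
    D′≡qmD = rearrange q k m N
      where
      rearrange : ∀ q k m N → 1 * (2 * (q * k)) * (2 * (m * N)) ≡ q * m * (1 * (2 * k) * (2 * N))
      rearrange = solve-∀
    cross : (+ q ℤ.* + m) ℤ.* Sχ h k N ℤ.* + D ≡ Sχ h k N ℤ.* + D′
    cross = trans (rearrange (+ q) (+ m) (Sχ h k N) (+ D))
                  (cong (Sχ h k N ℤ.*_) (sym (trans (cong +_ D′≡qmD) (trans (ℤP.pos-* (q * m) D) (cong (ℤ._* + D) (ℤP.pos-* q m))))))
      where
      rearrange : ∀ q m S D → q ℤ.* m ℤ.* S ℤ.* D ≡ S ℤ.* (q ℤ.* m ℤ.* D)
      rearrange = ℤ-Solver.solve-∀

  tχ-scale : ∀ h k q m .{{_ : NonZero k}} .{{_ : NonZero q}} .{{_ : NonZero m}} →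
             φ p (q * k) * (q * k) ≡ m * (φ p k * k) → q * φ p (q * k) ≡ m * φ p k →
             tχ p (q * h) (q * k) ≡ ((+ q) ÷ℤ 1) ℚ.* tχ p h k
  tχ-scale h k q m N′≡mN qφ′≡mφ = begin
    Tχ (q * h) (q * k) (φ′ * (q * k)) ÷ℤ φ′  ≡⟨ cong (λ M → Tχ (q * h) (q * k) M ÷ℤ φ′) N′≡mN ⟩
    Tχ (q * h) (q * k) (m * N) ÷ℤ φ′         ≡⟨ cong (_÷ℤ φ′) (trans (Tχ-cancel q h k (m * N)) (Tχ-periods h k (φ p k) m (p∣φ*k k))) ⟩
    (+ m ℤ.* Tχ h k N) ÷ℤ φ′                 ≡⟨ ÷ℤ-cross _ _ φ′ (1 * φ p k) cross ⟩
    (+ q ℤ.* Tχ h k N) ÷ℤ (1 * φ p k)        ≡⟨ ÷ℤ-* (+ q) (Tχ h k N) 1 (φ p k) ⟨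
    ((+ q) ÷ℤ 1) ℚ.* (Tχ h k N ÷ℤ φ p k)     ∎
    where
    φ′ = φ p (q * k)
    N = φ p k * k
    instance
      φ≢0′ : NonZero (φ p k)
      φ≢0′ = φ≢0 k
      φ′≢0 : NonZero φ′
      φ′≢0 = φ≢0 (q * k)
      1φ≢0 : NonZero (1 * φ p k)
      1φ≢0 = ℕP.m*n≢0 1 (φ p k)
    cross : + m ℤ.* Tχ h k N ℤ.* + (1 * φ p k) ≡ + q ℤ.* Tχ h k N ℤ.* + φ′
    cross = begin
      + m ℤ.* τ ℤ.* + (1 * φ p k)    ≡⟨ cong (λ f → + m ℤ.* τ ℤ.* + f) (ℕP.*-identityˡ (φ p k)) ⟩
      + m ℤ.* τ ℤ.* + φ p k          ≡⟨ rearrange (+ m) τ (+ φ p k) ⟩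
      τ ℤ.* (+ m ℤ.* + φ p k)        ≡⟨ cong (τ ℤ.*_) (trans (sym (ℤP.pos-* m (φ p k))) (trans (cong +_ (sym qφ′≡mφ)) (ℤP.pos-* q φ′))) ⟩
      τ ℤ.* (+ q ℤ.* + φ′)           ≡⟨ rearrange (+ q) τ (+ φ′) ⟨
      + q ℤ.* τ ℤ.* + φ′             ∎
      where
      τ = Tχ h k N
      rearrange : ∀ a t c → a ℤ.* t ℤ.* c ≡ t ℤ.* (a ℤ.* c)
      rearrange = ℤ-Solver.solve-∀

lemma8p3 : (p : ℕ) → Prime p → p % 4 ≡ 1 → (h k q : ℕ) → 0 < h → 0 < k → 0 < q →
    (sχ p (q * h) (q * k) ≡ sχ p h k) × (tχ p (q * h) (q * k) ≡ ((+ q) ÷ℤ 1) ℚ.* tχ p h k)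
lemma8p3 p p-prime p≡1[4] h k q _ 0<k 0<q with Scaling.lcm-scaling p p-prime p≡1[4] k q {{ℕ.>-nonZero 0<q}}
... | m , m≢0 , N′≡mN , qφ′≡mφ = sχ-scale h k q m N′≡mN , tχ-scale h k q m N′≡mN qφ′≡mφ
  where
  open Scaling p p-prime p≡1[4]
  instance
    k≢0 : NonZero k
    k≢0 = ℕ.>-nonZero 0<k
    q≢0 : NonZero q
    q≢0 = ℕ.>-nonZero 0<q
    m≢0′ : NonZero m
    m≢0′ = m≢0
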